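{- Let $n\ge1$. With commuting indeterminates $x_1,\dots,x_n,s,t$, $$\sum_{\sigma\in B_n}(-1)^{\mathrm{cyc}(\sigma)}s^{\mathrm{neg}(\sigma)}t^{\mathrm{nsum}(\sigma)}\prod_{i\in\mathrm{EXC_B}(\sigma)}x_i=-\Bigl(1+(-1)^{n-1}x_ns^nt^{\frac{n(n+1)}{2}}\Bigr)\prod_{j=1}^{n-1}(x_j-1).$$
   Context: $B_n$ is the set of permutations $\sigma$ of $\{\pm1,\dots,\pm n\}$ with $\sigma(-i)=-\sigma(i)$ for all $i\in[n]$, identified with the word $\sigma(1)\cdots\sigma(n)$; $|\sigma|$ denotes the permutation $i\mapsto|\sigma(i)|$ of $[n]$, and $\mathrm{cyc}(\sigma)$ is the number of cycles of $|\sigma|$. $\mathrm{Neg}(\sigma)=\{i\in[n]:\sigma(i)<0\}$, $\mathrm{neg}(\sigma)=\#\mathrm{Neg}(\sigma)$, $\mathrm{nsum}(\sigma)=\sum_{i\in\mathrm{Neg}(\sigma)}|\sigma(i)|$. The set of type B excedances is $\mathrm{EXC_B}(\sigma)=\{|\sigma(i)|:i\in[n],\ \sigma(|\sigma(i)|)=-|\sigma(i)|\text{ or }\sigma(|\sigma(i)|)>\sigma(i)\}$. -}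

module Defs where

open import Level using (Level)
open import Data.Nat as ℕ using (ℕ; zero; suc; _/_)
open import Data.Fin as Fin using (Fin; toℕ; fromℕ; inject₁)
open import Data.Bool using (Bool; true; false; if_then_else_; _∧_; _∨_; not)
open import Data.Product using (_×_; _,_; proj₁; proj₂)
open import Data.List as List using (List; []; _∷_; map; concatMap; filterᵇ; foldr; length; allFin; upTo)
open import Data.Bool.ListAction using (all; any)
open import Data.Nat.ListAction using (sum)
open import Data.Vec as Vec using (Vec; lookup)
open import Data.Integer as ℤ using (ℤ)
open import Relation.Nullary.Decidable using (⌊_⌋)
open import Algebra.Bundles using (CommutativeRing)

-- A signed letter: (b , k) represents -(k+1) if b = true, and +(k+1) if b = false.
-- So letters range over ±[n].
SV : ℕ → Set
SV n = Bool × Fin n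

sval : ∀ {n} → SV n → ℤ
sval (true  , k) = ℤ.- (ℤ.+ suc (toℕ k))
sval (false , k) = ℤ.+ suc (toℕ k)

allSV : ∀ n → List (SV n)
allSV n = concatMap (λ b → map (b ,_) (allFin n)) (true ∷ false ∷ [])

allVecs : ∀ {A : Set} → List A → (k : ℕ) → List (Vec A k)
allVecs xs zero    = Vec.[] ∷ []
allVecs xs (suc k) = concatMap (λ a → map (a Vec.∷_) (allVecs xs k)) xs

-- A signed permutation σ ∈ B_n, identified with its word σ(1)⋯σ(n).
-- absolute value permutation |σ|
absP : ∀ {n} → Vec (SV n) n → Fin n → Fin n
absP w i = proj₂ (lookup w i)

isSignedPerm : ∀ {n} → Vec (SV n) n → Bool
isSignedPerm {n} w =
  all (λ i → all (λ j → not ⌊ absP w i Fin.≟ absP w j ⌋ ∨ ⌊ i Fin.≟ j ⌋) (allFin n)) (allFin n)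

Bn : ∀ n → List (Vec (SV n) n)
Bn n = filterᵇ isSignedPerm (allVecs (allSV n) n)

iter : ∀ {A : Set} → (A → A) → ℕ → A → A
iter f zero    a = a
iter f (suc k) a = f (iter f k a)

countᵇ : ∀ {A : Set} → (A → Bool) → List A → ℕ
countᵇ p xs = length (filterᵇ p xs)

-- number of cycles of |σ|: count elements i that are the minimum of their cycle,
-- i.e. toℕ i ≤ toℕ (|σ|^k i) for k = 1,…,n (every cycle has length ≤ n).
cyc : ∀ {n} → Vec (SV n) n → ℕ
cyc {n} w = countᵇ (λ i → all (λ k → ⌊ toℕ i ℕ.≤? toℕ (iter (absP w) k i) ⌋) (map suc (upTo n))) (allFin n)

neg : ∀ {n} → Vec (SV n) n → ℕ
neg {n} w = countᵇ (λ i → proj₁ (lookup w i)) (allFin n)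

nsum : ∀ {n} → Vec (SV n) n → ℕ
nsum {n} w = sum (map (λ i → if proj₁ (lookup w i) then suc (toℕ (absP w i)) else 0) (allFin n))

-- condition on position i: σ(|σ(i)|) = -|σ(i)|  or  σ(|σ(i)|) > σ(i)
excCond : ∀ {n} → Vec (SV n) n → Fin n → Bool
excCond w i =
  let k = absP w i
      v = lookup w k
  in (proj₁ v ∧ ⌊ proj₂ v Fin.≟ k ⌋) ∨ ⌊ sval (lookup w i) ℤ.<? sval v ⌋

inEXCB : ∀ {n} → Vec (SV n) n → Fin n → Bool
inEXCB {n} w j = any (λ i → ⌊ absP w i Fin.≟ j ⌋ ∧ excCond w i) (allFin n)

-- Polynomial identity, stated as an identity in an arbitrary commutative ring
-- (equivalent to an identity in ℤ[x₁,…,xₙ,s,t] by taking R to be that ring).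
module _ {c ℓ : Level} (R : CommutativeRing c ℓ) where
  open CommutativeRing R

  pow : Carrier → ℕ → Carrier
  pow a zero    = 1#
  pow a (suc k) = a * pow a k

  sumR : List Carrier → Carrier
  sumR = foldr _+_ 0#

  prodR : List Carrier → Carrier
  prodR = foldr _*_ 1#

  -- Σ_{σ∈B_n} (-1)^cyc s^neg t^nsum ∏_{i∈EXC_B} x_i   (x_i is x at index i-1)
  lhs : (n : ℕ) → (Fin n → Carrier) → Carrier → Carrier → Carrier
  lhs n x s t = sumR (map (λ w →
      pow (- 1#) (cyc w) * pow s (neg w) * pow t (nsum w)
        * prodR (map (λ j → if inEXCB w j then x j else 1#) (allFin n)))
    (Bn n))

  -- for n = suc m:  -(1 + (-1)^(n-1) x_n s^n t^(n(n+1)/2)) ∏_{j=1}^{n-1} (x_j - 1)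
  rhs : (m : ℕ) → (Fin (suc m) → Carrier) → Carrier → Carrier → Carrier
  rhs m x s t =
    - (1# + pow (- 1#) m * x (fromℕ m) * pow s (suc m) * pow t ((suc m ℕ.* (suc m ℕ.+ 1)) / 2))
      * prodR (map (λ j → x (inject₁ j) + - 1#) (allFin m))

-- Weight every j ∉ EXC_B(σ) by a second variable z_j instead of 1. The sum then equals
-- -(z_n + (-1)^(n-1) x_n s^n t^(n(n+1)/2)) ∏_{j<n} (x_j - z_j), proved by induction on n. Every σ ∈ B_{n+1}
-- arises from a unique w ∈ B_n by inserting the letter ±(n+1), either as a new fixed point of |σ| or spliced
-- into the cycle of |w| through a position i (σ(i) = ±(n+1), σ(n+1) = w(i)). A new fixed point adds a cycle
-- and contributes the factor z_{n+1} or x_{n+1} s t^(n+1). A splice keeps the number of cycles and makes the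
-- status of i independent of w, so it contributes the sum over B_n with x_i and z_i both replaced by a single
-- value c. By induction that sum contains the factor c - c = 0 unless i = n, and the surviving terms
-- recombine into the closed form for n + 1.

module Submission where

open import Defs
open import Algebra.Bundles using (CommutativeMonoid; CommutativeRing)
open import Algebra.Solver.Ring.AlmostCommutativeRing using (_-Raw-AlmostCommutative⟶_; fromCommutativeRing)
open import Data.Bool.Base using (Bool; true; false; T; not; _∧_; _∨_; if_then_else_)
open import Data.Bool.ListAction using (all)
open import Data.Bool.Properties using (T?; T-∧; ∧-zeroʳ; ∧-identityʳ; ∨-identityʳ; if-not; if-eta)
open import Data.Fin.Base using (Fin; zero; suc; toℕ; inject₁; fromℕ; lower₁; punchIn)
open import Data.Fin.Properties
  using (_≟_; pigeonhole; punchInᵢ≢i; fromℕ≢inject₁; inject₁-injective; inject₁-lower₁; inject₁ℕ<;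
         toℕ-injective; toℕ-inject₁; toℕ-fromℕ; toℕ<n; toℕ≤pred[n]; ≤fromℕ)
open import Data.Integer.Base as ℤ using (ℤ; -[1+_]; 0ℤ; 1ℤ; _⊖_; _◃_; -<-; -<+; +<+)
import Data.Integer.Properties as ℤ
open import Data.List.Base as List
  using (List; []; _∷_; _++_; map; foldr; concatMap; allFin; upTo; cartesianProductWith; cartesianProduct)
open import Data.List.Membership.Propositional using (_∈_; lose)
open import Data.List.Membership.Propositional.Properties
  using (∈-allFin; ∈-upTo⁺; ∈-map⁺; ∈-map⁻; ∈-cartesianProductWith⁺; ∈-cartesianProduct⁺; ∈-cartesianProduct⁻;
         ∈-filter⁺; ∈-filter⁻)
open import Data.List.Membership.Propositional.Properties.WithK using (unique∧set⇒bag)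
open import Data.List.Properties using (map-tabulate; map-∘)
open import Data.List.Relation.Binary.BagAndSetEquality using (∼bag⇒↭)
open import Data.List.Relation.Binary.Permutation.Propositional using (_↭_; ↭⇒↭ₛ′)
import Data.List.Relation.Binary.Permutation.Propositional.Properties as ↭
import Data.List.Relation.Binary.Permutation.Setoid.Properties as ↭ₛ
import Data.List.Relation.Unary.All as All
open import Data.List.Relation.Unary.All.Properties using (all⁺; all⁻)
open import Data.List.Relation.Unary.Any using (here; there; satisfied)
open import Data.List.Relation.Unary.Any.Properties using (any⁺; any⁻)
open import Data.List.Relation.Unary.Unique.Propositional using (Unique; []; _∷_)
import Data.List.Relation.Unary.Unique.Propositional.Properties as Unique
open import Data.Maybe.Base using (Maybe; just; nothing; is-just)
open import Data.Maybe.Properties using (just-injective)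
open import Data.Nat.Base as ℕ using (ℕ; zero; suc; _≤_; _<_; s≤s)
open import Data.Nat.DivMod using (_%_; _/_; m≡m%n+[m/n]*n; m%n<n; +-distrib-/-∣ʳ; m*n/n≡m)
open import Data.Nat.Divisibility using (divides)
open import Data.Nat.ListAction using (sum)
open import Data.Nat.Properties as ℕ
  using (_≤?_; ≤-refl; ≤-trans; <⇒≤; <⇒≱; +-suc; m≤n⇒∃[o]m+o≡n; n<1+n; m≤n+m; +-0-commutativeMonoid)
open import Data.Nat.Solver using (module +-*-Solver)
open import Data.Product.Base using (∃-syntax; _×_; _,_; proj₁; proj₂)
import Data.Sign.Base as Sign
open import Data.Sum.Base using (_⊎_; inj₁; inj₂)
open import Data.Vec.Base as Vec using (Vec; []; _∷_; lookup; _[_]≔_; _∷ʳ_)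
open import Data.Vec.Functional using (updateAt)
open import Data.Vec.Functional.Properties using (updateAt-updates; updateAt-minimal)
open import Data.Vec.Properties
  using (∷-injective; lookup-map; lookup∘update; lookup∘update′; lookup∘tabulate; tabulate∘lookup; tabulate-cong)
open import Function.Base using (_∘_; const)
open import Function.Bundles using (_⇔_; mk⇔; Equivalence)
open import Function.Definitions using (Injective)
open import Level using (Level)
open import Relation.Binary.PropositionalEquality.Core as ≡ using (_≡_; _≢_; refl; sym; trans; cong; cong₂; subst; subst₂)
open import Relation.Binary.PropositionalEquality.Properties using (module ≡-Reasoning)
open import Relation.Nullary.Decidable using (Dec; yes; no; ⌊_⌋; isYes≗does; dec-true; dec-false; toWitness; fromWitness)
open import Relation.Nullary.Negation.Core using (¬_; contradiction)

T-injective : ∀ {a b} → (T a → T b) → (T b → T a) → a ≡ b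
T-injective {false} {false} _ _ = refl
T-injective {false} {true}  _ g = contradiction (g _) λ ()
T-injective {true}  {b}     f _ with b | f _
... | true | _ = refl

isYes-true : ∀ {p} {P : Set p} (P? : Dec P) → P → ⌊ P? ⌋ ≡ true
isYes-true P? p = trans (isYes≗does P?) (dec-true P? p)

isYes-false : ∀ {p} {P : Set p} (P? : Dec P) → ¬ P → ⌊ P? ⌋ ≡ false
isYes-false P? ¬p = trans (isYes≗does P?) (dec-false P? ¬p)

iter-+ : ∀ {A : Set} (f : A → A) k j x → iter f (k ℕ.+ j) x ≡ iter f k (iter f j x)
iter-+ f zero    j x = refl
iter-+ f (suc k) j x = cong f (iter-+ f k j x)

iter-injective : ∀ {A : Set} {f : A → A} → Injective _≡_ _≡_ f →
                 ∀ k {x y} → iter f k x ≡ iter f k y → x ≡ y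
iter-injective inj zero    eq = eq
iter-injective inj (suc k) eq = iter-injective inj k (inj eq)

iter-*-period : ∀ {A : Set} (f : A → A) {p x} → iter f p x ≡ x → ∀ k → iter f (k ℕ.* p) x ≡ x
iter-*-period f {p} {x} fᵖx≡x zero    = refl
iter-*-period f {p} {x} fᵖx≡x (suc k) = begin
  iter f (p ℕ.+ k ℕ.* p) x      ≡⟨ iter-+ f p (k ℕ.* p) x ⟩
  iter f p (iter f (k ℕ.* p) x) ≡⟨ cong (iter f p) (iter-*-period f fᵖx≡x k) ⟩
  iter f p x                    ≡⟨ fᵖx≡x ⟩
  x                             ∎
  where open ≡-Reasoning

iter-fixed : ∀ {A : Set} {f : A → A} {x} → f x ≡ x → ∀ r → iter f r x ≡ x
iter-fixed fx≡x zero    = refl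
iter-fixed {f = f} fx≡x (suc r) = trans (cong f (iter-fixed fx≡x r)) fx≡x

IsCycleMin : ∀ {n} → (Fin n → Fin n) → Fin n → Set
IsCycleMin π a = ∀ r → toℕ a ≤ toℕ (iter π r a)

-- Definitionally the test counted by cyc.
isCycleMin : ∀ {n} → (Fin n → Fin n) → Fin n → Bool
isCycleMin {n} π a = all (λ k → ⌊ toℕ a ≤? toℕ (iter π k a) ⌋) (map suc (upTo n))

module _ {n} {π : Fin n → Fin n} (inj : Injective _≡_ _≡_ π) where

  period : ∀ a → ∃[ p ] suc p ≤ n × iter π (suc p) a ≡ a
  period a with i , j , i<j , πⁱa≡πʲa ← pigeonhole (n<1+n n) (λ k → iter π (toℕ k) a)
    with p , i+1+p≡j ← m≤n⇒∃[o]m+o≡n i<j =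
    p , ≤-trans (subst (suc p ≤_) i+1+p≡j (s≤s (m≤n+m p (toℕ i)))) (toℕ≤pred[n] j) ,
    sym (iter-injective inj (toℕ i) (begin
      iter π (toℕ i) a                   ≡⟨ πⁱa≡πʲa ⟩
      iter π (toℕ j) a                   ≡⟨ cong (λ k → iter π k a) (trans (sym i+1+p≡j) (sym (+-suc (toℕ i) p))) ⟩
      iter π (toℕ i ℕ.+ suc p) a         ≡⟨ iter-+ π (toℕ i) (suc p) a ⟩
      iter π (toℕ i) (iter π (suc p) a)  ∎))
    where open ≡-Reasoning

  hasPreimage : ∀ a → ∃[ b ] π b ≡ a
  hasPreimage a with p , _ , πᵖ⁺¹a≡a ← period a = iter π p a , πᵖ⁺¹a≡a

  isCycleMin⇔IsCycleMin : ∀ a → T (isCycleMin π a) ⇔ IsCycleMin π a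
  isCycleMin⇔IsCycleMin a = mk⇔ to from
    where
    to : T (isCycleMin π a) → IsCycleMin π a
    to t r with p , p<n , πᵖ⁺¹a≡a ← period a =
      subst (λ x → toℕ a ≤ toℕ x) (sym πʳa≡πʳ′a) (bounded r′ (≤-trans (<⇒≤ (m%n<n r (suc p))) p<n))
      where
      bounded : ∀ k → k ≤ n → toℕ a ≤ toℕ (iter π k a)
      bounded zero    _   = ≤-refl
      bounded (suc k) k<n = toWitness (All.lookup (all⁺ _ _ t) (∈-map⁺ suc (∈-upTo⁺ k<n)))
      r′ q : ℕ
      r′ = r % suc p
      q = r / suc p
      πʳa≡πʳ′a : iter π r a ≡ iter π r′ a
      πʳa≡πʳ′a = begin
        iter π r a                          ≡⟨ cong (λ k → iter π k a) (m≡m%n+[m/n]*n r (suc p)) ⟩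
        iter π (r′ ℕ.+ q ℕ.* suc p) a       ≡⟨ iter-+ π r′ (q ℕ.* suc p) a ⟩
        iter π r′ (iter π (q ℕ.* suc p) a)  ≡⟨ cong (iter π r′) (iter-*-period π πᵖ⁺¹a≡a q) ⟩
        iter π r′ a                         ∎
        where open ≡-Reasoning
    from : IsCycleMin π a → T (isCycleMin π a)
    from min = all⁻ (λ k → ⌊ toℕ a ≤? toℕ (iter π k a) ⌋) {map suc (upTo n)}
      (All.tabulate λ {k} _ → fromWitness (min k))

-- g is f with the new point n inserted into at most one edge b ↦ f b, as b ↦ n ↦ f b.
module Splice {n} (f : Fin n → Fin n) (g : Fin (suc n) → Fin (suc n))
  (g-inject₁ : ∀ b → g (inject₁ b) ≡ inject₁ (f b) ⊎ (g (inject₁ b) ≡ fromℕ n × g (fromℕ n) ≡ inject₁ (f b)))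
  where

  orbit-lift : ∀ b q → ∃[ r ] iter g r (inject₁ b) ≡ inject₁ (iter f q b)
  orbit-lift b zero = 0 , refl
  orbit-lift b (suc q) with r , gʳb≡fᵠb ← orbit-lift b q | g-inject₁ (iter f q b)
  ... | inj₁ eq         = suc r , trans (cong g gʳb≡fᵠb) eq
  ... | inj₂ (eq , eq′) = suc (suc r) , trans (cong (g ∘ g) gʳb≡fᵠb) (trans (cong g eq) eq′)

  orbit-project : ∀ b r → ∃[ q ] (iter g r (inject₁ b) ≡ inject₁ (iter f q b)
                    ⊎ iter g r (inject₁ b) ≡ fromℕ n × g (fromℕ n) ≡ inject₁ (iter f (suc q) b))
  orbit-project b zero = 0 , inj₁ refl
  orbit-project b (suc r) with orbit-project b r
  ... | q , inj₂ (gʳb≡n , eq) = suc q , inj₁ (trans (cong g gʳb≡n) eq)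
  ... | q , inj₁ gʳb≡fᵠb with g-inject₁ (iter f q b)
  ...   | inj₁ eq         = suc q , inj₁ (trans (cong g gʳb≡fᵠb) eq)
  ...   | inj₂ (eq , eq′) = q , inj₂ (trans (cong g gʳb≡fᵠb) eq , eq′)

  IsCycleMin-inject₁ : ∀ b → IsCycleMin g (inject₁ b) ⇔ IsCycleMin f b
  IsCycleMin-inject₁ b = mk⇔ to from
    where
    to : IsCycleMin g (inject₁ b) → IsCycleMin f b
    to min q with r , eq ← orbit-lift b q =
      subst₂ _≤_ (toℕ-inject₁ b) (trans (cong toℕ eq) (toℕ-inject₁ _)) (min r)
    from : IsCycleMin f b → IsCycleMin g (inject₁ b)
    from min r with orbit-project b r
    ... | q , inj₁ eq       = subst₂ _≤_ (sym (toℕ-inject₁ b)) (sym (trans (cong toℕ eq) (toℕ-inject₁ _))) (min q)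
    ... | q , inj₂ (eq , _) = subst (toℕ (inject₁ b) ≤_) (sym (cong toℕ eq)) (≤fromℕ (inject₁ b))

module Summation {a ℓ} (M : CommutativeMonoid a ℓ) where
  open CommutativeMonoid M renaming (Carrier to A; refl to ≈-refl; sym to ≈-sym; trans to ≈-trans)
  open import Algebra.Properties.CommutativeMonoid.Sum M using (sum-init-last; sum-remove) renaming (sum to sumᵛ)
  open import Algebra.Solver.CommutativeMonoid M using (solve; _⊕_; _⊜_)
  open import Relation.Binary.Reasoning.Setoid setoid

  sumOver : ∀ {b} {B : Set b} → (B → A) → List B → A
  sumOver f xs = foldr _∙_ ε (map f xs)

  ∑ : ∀ {n} → (Fin n → A) → A
  ∑ f = sumOver f (allFin _)

  private
    variable
      b : Level
      B C : Set b

  sumOver-++ : ∀ (f : B → A) xs ys → sumOver f (xs ++ ys) ≈ sumOver f xs ∙ sumOver f ys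
  sumOver-++ f []       ys = ≈-sym (identityˡ _)
  sumOver-++ f (x ∷ xs) ys = ≈-trans (∙-congˡ (sumOver-++ f xs ys)) (≈-sym (assoc _ _ _))

  sumOver-cong : ∀ {f g : B → A} xs → (∀ {x} → x ∈ xs → f x ≈ g x) → sumOver f xs ≈ sumOver g xs
  sumOver-cong []       f≈g = ≈-refl
  sumOver-cong (x ∷ xs) f≈g = ∙-cong (f≈g (here ≡.refl)) (sumOver-cong xs (f≈g ∘ there))

  sumOver-↭ : ∀ (f : B → A) {xs ys} → xs ↭ ys → sumOver f xs ≈ sumOver f ys
  sumOver-↭ f p = ↭ₛ.foldr-commMonoid setoid isCommutativeMonoid (↭⇒↭ₛ′ isEquivalence (↭.map⁺ f p))

  sumOver-identity : ∀ {f : B → A} xs → (∀ x → f x ≈ ε) → sumOver f xs ≈ ε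
  sumOver-identity []       f≈ε = ≈-refl
  sumOver-identity (x ∷ xs) f≈ε = ≈-trans (∙-cong (f≈ε x) (sumOver-identity xs f≈ε)) (identityˡ ε)

  sumOver-distrib : ∀ (f g : B → A) xs → sumOver (λ x → f x ∙ g x) xs ≈ sumOver f xs ∙ sumOver g xs
  sumOver-distrib f g []       = ≈-sym (identityˡ ε)
  sumOver-distrib f g (x ∷ xs) = begin
    (f x ∙ g x) ∙ sumOver (λ x → f x ∙ g x) xs   ≈⟨ ∙-congˡ (sumOver-distrib f g xs) ⟩
    (f x ∙ g x) ∙ (sumOver f xs ∙ sumOver g xs)  ≈⟨ interchange _ _ _ _ ⟩
    (f x ∙ sumOver f xs) ∙ (g x ∙ sumOver g xs)  ∎
    where open import Algebra.Properties.CommutativeSemigroup commutativeSemigroup using (interchange)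

  sumOver-comm : ∀ (f : B → C → A) xs ys →
                 sumOver (λ x → sumOver (f x) ys) xs ≈ sumOver (λ y → sumOver (λ x → f x y) xs) ys
  sumOver-comm f []       ys = ≈-sym (sumOver-identity ys (λ _ → ≈-refl))
  sumOver-comm f (x ∷ xs) ys = begin
    sumOver (f x) ys ∙ sumOver (λ x → sumOver (f x) ys) xs        ≈⟨ ∙-congˡ (sumOver-comm f xs ys) ⟩
    sumOver (f x) ys ∙ sumOver (λ y → sumOver (λ x → f x y) xs) ys ≈⟨ sumOver-distrib (f x) _ ys ⟨
    sumOver (λ y → f x y ∙ sumOver (λ x → f x y) xs) ys            ∎

  sumOver-map : ∀ (f : C → A) (g : B → C) xs → sumOver f (map g xs) ≡ sumOver (f ∘ g) xs
  sumOver-map f g xs = ≡.cong (foldr _∙_ ε) (≡.sym (map-∘ xs))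

  sumOver-cartesianProduct : ∀ (f : B × C → A) xs ys →
    sumOver f (cartesianProduct xs ys) ≈ sumOver (λ x → sumOver (λ y → f (x , y)) ys) xs
  sumOver-cartesianProduct f []       ys = ≈-refl
  sumOver-cartesianProduct f (x ∷ xs) ys = begin
    sumOver f (map (x ,_) ys ++ cartesianProduct xs ys)
      ≈⟨ sumOver-++ f (map (x ,_) ys) _ ⟩
    sumOver f (map (x ,_) ys) ∙ sumOver f (cartesianProduct xs ys)
      ≈⟨ ∙-cong (reflexive (sumOver-map f (x ,_) ys)) (sumOver-cartesianProduct f xs ys) ⟩
    sumOver (λ y → f (x , y)) ys ∙ sumOver (λ x → sumOver (λ y → f (x , y)) ys) xs ∎

  ∑≡sumᵛ : ∀ {n} (f : Fin n → A) → ∑ f ≡ sumᵛ f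
  ∑≡sumᵛ f = ≡.trans (≡.cong (foldr _∙_ ε) (map-tabulate (λ i → i) f)) (foldr-tabulate f)
    where
    foldr-tabulate : ∀ {n} (f : Fin n → A) → foldr _∙_ ε (List.tabulate f) ≡ sumᵛ f
    foldr-tabulate {ℕ.zero}  f = ≡.refl
    foldr-tabulate {ℕ.suc n} f = ≡.cong (f zero ∙_) (foldr-tabulate (f ∘ suc))

  ∑-cong : ∀ {n} {f g : Fin n → A} → (∀ i → f i ≈ g i) → ∑ f ≈ ∑ g
  ∑-cong f≈g = sumOver-cong (allFin _) (λ {i} _ → f≈g i)

  ∑-init-last : ∀ {n} (f : Fin (ℕ.suc n) → A) → ∑ f ≈ ∑ (f ∘ inject₁) ∙ f (fromℕ n)
  ∑-init-last f = begin
    ∑ f                     ≡⟨ ∑≡sumᵛ f ⟩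
    sumᵛ f                  ≈⟨ sum-init-last f ⟩
    sumᵛ (f ∘ inject₁) ∙ _  ≡⟨ ≡.cong (_∙ _) (∑≡sumᵛ (f ∘ inject₁)) ⟨
    ∑ (f ∘ inject₁) ∙ _     ∎

  ∑-remove : ∀ {n} (i : Fin (ℕ.suc n)) (f : Fin (ℕ.suc n) → A) → ∑ f ≈ f i ∙ ∑ (f ∘ punchIn i)
  ∑-remove i f = begin
    ∑ f                         ≡⟨ ∑≡sumᵛ f ⟩
    sumᵛ f                      ≈⟨ sum-remove f ⟩
    f i ∙ sumᵛ (f ∘ punchIn i)  ≡⟨ ≡.cong (f i ∙_) (∑≡sumᵛ (f ∘ punchIn i)) ⟨
    f i ∙ ∑ (f ∘ punchIn i)     ∎

  private
    ∑-cong-punchIn : ∀ {n} {f g : Fin (ℕ.suc n) → A} i → (∀ j → j ≢ i → f j ≈ g j) →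
                     ∑ (f ∘ punchIn i) ≈ ∑ (g ∘ punchIn i)
    ∑-cong-punchIn i f≈g = ∑-cong (λ j → f≈g (punchIn i j) (punchInᵢ≢i i j))

  ∑-update : ∀ {n} {f g : Fin n → A} i → (∀ j → j ≢ i → f j ≈ g j) →
             ∀ x → f i ∙ x ≈ g i → ∑ f ∙ x ≈ ∑ g
  ∑-update {ℕ.suc _} {f} {g} i f≈g x fᵢx≈gᵢ = begin
    ∑ f ∙ x                         ≈⟨ ∙-congʳ (∑-remove i f) ⟩
    (f i ∙ ∑ (f ∘ punchIn i)) ∙ x   ≈⟨ solve 3 (λ a r b → (a ⊕ r) ⊕ b ⊜ (a ⊕ b) ⊕ r) ≈-refl (f i) _ x ⟩
    (f i ∙ x) ∙ ∑ (f ∘ punchIn i)   ≈⟨ ∙-cong fᵢx≈gᵢ (∑-cong-punchIn i f≈g) ⟩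
    g i ∙ ∑ (g ∘ punchIn i)         ≈⟨ ∑-remove i g ⟨
    ∑ g                             ∎

  ∑-exchange : ∀ {n} {f g : Fin n → A} i → (∀ j → j ≢ i → f j ≈ g j) → ∑ f ∙ g i ≈ ∑ g ∙ f i
  ∑-exchange {ℕ.suc _} {f} {g} i f≈g = begin
    ∑ f ∙ g i                       ≈⟨ ∙-congʳ (∑-remove i f) ⟩
    (f i ∙ ∑ (f ∘ punchIn i)) ∙ g i ≈⟨ ∙-congʳ (∙-congˡ (∑-cong-punchIn i f≈g)) ⟩
    (f i ∙ ∑ (g ∘ punchIn i)) ∙ g i ≈⟨ solve 3 (λ a r b → (a ⊕ r) ⊕ b ⊜ (b ⊕ r) ⊕ a) ≈-refl (f i) _ (g i) ⟩
    (g i ∙ ∑ (g ∘ punchIn i)) ∙ f i ≈⟨ ∙-congʳ (∑-remove i g) ⟨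
    ∑ g ∙ f i                       ∎

module IntegerCoefficients {c ℓ} (R : CommutativeRing c ℓ) where
  open CommutativeRing R renaming (refl to ≈-refl; sym to ≈-sym; trans to ≈-trans)
  open import Algebra.Properties.Ring ring using (-0#≈0#; -‿involutive; -‿+-comm; -‿distribˡ-*; -‿distribʳ-*)
  -- The optimised multiple makes ⟦ 1ℤ ⟧ reduce to 1#, so solver constants match the 1# in goals.
  open import Algebra.Properties.Semiring.Mult.TCOptimised semiring
    using (1+×; ×-homo-+; ×1-homo-*) renaming (_×_ to _·_)
  open import Relation.Binary.Reasoning.Setoid setoid

  ⟦_⟧ : ℤ → Carrier
  ⟦ ℤ.+ n ⟧    = n · 1#
  ⟦ -[1+ n ] ⟧ = - (suc n · 1#)

  ⟦⊖⟧ : ∀ m n → ⟦ m ⊖ n ⟧ ≈ m · 1# - n · 1#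
  ⟦⊖⟧ m       zero    = ≈-trans (≈-sym (+-identityʳ _)) (+-congˡ (≈-sym -0#≈0#))
  ⟦⊖⟧ zero    (suc n) = ≈-sym (+-identityˡ _)
  ⟦⊖⟧ (suc m) (suc n) = begin
    ⟦ suc m ⊖ suc n ⟧        ≡⟨ ≡.cong ⟦_⟧ (ℤ.[1+m]⊖[1+n]≡m⊖n m n) ⟩
    ⟦ m ⊖ n ⟧                ≈⟨ ⟦⊖⟧ m n ⟩
    a - b                    ≈⟨ +-identityˡ _ ⟨
    0# + (a - b)             ≈⟨ +-congʳ (-‿inverseʳ 1#) ⟨
    (1# - 1#) + (a - b)      ≈⟨ interchange 1# (- 1#) a (- b) ⟩
    (1# + a) + (- 1# - b)    ≈⟨ +-cong (1+× m 1#) (≈-trans (-‿cong (1+× n 1#)) (≈-sym (-‿+-comm 1# b))) ⟨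
    suc m · 1# - suc n · 1#  ∎
    where
    open import Algebra.Properties.CommutativeSemigroup +-commutativeSemigroup using (interchange)
    a = m · 1#
    b = n · 1#

  ⟦+◃⟧ : ∀ n → ⟦ Sign.+ ◃ n ⟧ ≈ n · 1#
  ⟦+◃⟧ zero    = ≈-refl
  ⟦+◃⟧ (suc n) = ≈-refl

  ⟦-◃⟧ : ∀ n → ⟦ Sign.- ◃ n ⟧ ≈ - (n · 1#)
  ⟦-◃⟧ zero    = ≈-sym -0#≈0#
  ⟦-◃⟧ (suc n) = ≈-refl

  ⟦⟧-+-homo : ∀ i j → ⟦ i ℤ.+ j ⟧ ≈ ⟦ i ⟧ + ⟦ j ⟧
  ⟦⟧-+-homo (ℤ.+ m)  (ℤ.+ n)  = ×-homo-+ 1# m n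
  ⟦⟧-+-homo (ℤ.+ m)  -[1+ n ] = ⟦⊖⟧ m (suc n)
  ⟦⟧-+-homo -[1+ m ] (ℤ.+ n)  = ≈-trans (⟦⊖⟧ n (suc m)) (+-comm _ _)
  ⟦⟧-+-homo -[1+ m ] -[1+ n ] = begin
    - (suc (suc (m ℕ.+ n)) · 1#)       ≡⟨ ≡.cong (λ k → - (suc k · 1#)) (ℕ.+-suc m n) ⟨
    - ((suc m ℕ.+ suc n) · 1#)         ≈⟨ -‿cong (×-homo-+ 1# (suc m) (suc n)) ⟩
    - (suc m · 1# + suc n · 1#)        ≈⟨ -‿+-comm _ _ ⟨
    - (suc m · 1#) - (suc n · 1#)      ∎

  ⟦⟧-*-homo : ∀ i j → ⟦ i ℤ.* j ⟧ ≈ ⟦ i ⟧ * ⟦ j ⟧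
  ⟦⟧-*-homo (ℤ.+ m)  (ℤ.+ n)  = ≈-trans (⟦+◃⟧ (m ℕ.* n)) (×1-homo-* m n)
  ⟦⟧-*-homo (ℤ.+ m)  -[1+ n ] =
    ≈-trans (⟦-◃⟧ (m ℕ.* suc n)) (≈-trans (-‿cong (×1-homo-* m (suc n))) (-‿distribʳ-* _ _))
  ⟦⟧-*-homo -[1+ m ] (ℤ.+ n)  =
    ≈-trans (⟦-◃⟧ (suc m ℕ.* n)) (≈-trans (-‿cong (×1-homo-* (suc m) n)) (-‿distribˡ-* _ _))
  ⟦⟧-*-homo -[1+ m ] -[1+ n ] = begin
    ⟦ Sign.+ ◃ (suc m ℕ.* suc n) ⟧       ≈⟨ ⟦+◃⟧ (suc m ℕ.* suc n) ⟩
    (suc m ℕ.* suc n) · 1#               ≈⟨ ×1-homo-* (suc m) (suc n) ⟩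
    a * b                                ≈⟨ -‿involutive _ ⟨
    - - (a * b)                          ≈⟨ -‿cong (-‿distribˡ-* a b) ⟩
    - (- a * b)                          ≈⟨ -‿distribʳ-* (- a) b ⟩
    - a * - b                            ∎
    where a = suc m · 1#; b = suc n · 1#

  ⟦⟧-‿homo : ∀ i → ⟦ ℤ.- i ⟧ ≈ - ⟦ i ⟧
  ⟦⟧-‿homo (ℤ.+ zero)  = ≈-sym -0#≈0#
  ⟦⟧-‿homo (ℤ.+ suc n) = ≈-refl
  ⟦⟧-‿homo -[1+ n ]    = ≈-sym (-‿involutive _)

  homomorphism : ℤ.+-*-rawRing -Raw-AlmostCommutative⟶ fromCommutativeRing R
  homomorphism = record
    { ⟦_⟧    = ⟦_⟧
    ; +-homo = ⟦⟧-+-homo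
    ; *-homo = ⟦⟧-*-homo
    ; -‿homo = ⟦⟧-‿homo
    ; 0-homo = ≈-refl
    ; 1-homo = ≈-refl
    }

  ⟦⟧-≟ : ∀ i j → Maybe (⟦ i ⟧ ≈ ⟦ j ⟧)
  ⟦⟧-≟ i j with i ℤ.≟ j
  ... | yes ≡.refl = just ≈-refl
  ... | no _       = nothing

  open import Algebra.Solver.Ring ℤ.+-*-rawRing (fromCommutativeRing R) homomorphism ⟦⟧-≟ public
    using (solve; _:+_; _:*_; :-_; _:=_; con)

Word : ℕ → Set
Word n = Vec (SV n) n

IsSignedPerm : ∀ {n} → Word n → Set
IsSignedPerm w = Injective _≡_ _≡_ (absP w)

lookup-ext : ∀ {A : Set} {n} {v w : Vec A n} → (∀ k → lookup v k ≡ lookup w k) → v ≡ w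
lookup-ext {v = v} {w} eq = trans (sym (tabulate∘lookup v)) (trans (tabulate-cong eq) (tabulate∘lookup w))

lookup-∷ʳ-inject₁ : ∀ {A : Set} {n} (xs : Vec A n) x k → lookup (xs ∷ʳ x) (inject₁ k) ≡ lookup xs k
lookup-∷ʳ-inject₁ (y ∷ xs) x zero    = refl
lookup-∷ʳ-inject₁ (y ∷ xs) x (suc k) = lookup-∷ʳ-inject₁ xs x k

lookup-∷ʳ-fromℕ : ∀ {A : Set} {n} (xs : Vec A n) x → lookup (xs ∷ʳ x) (fromℕ n) ≡ x
lookup-∷ʳ-fromℕ []       x = refl
lookup-∷ʳ-fromℕ (y ∷ xs) x = lookup-∷ʳ-fromℕ xs x

injectLetter : ∀ {n} → SV n → SV (suc n)
injectLetter (ε , k) = ε , inject₁ k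

injectLetter-injective : ∀ {n} {a b : SV n} → injectLetter a ≡ injectLetter b → a ≡ b
injectLetter-injective eq = cong₂ _,_ (cong proj₁ eq) (inject₁-injective (cong proj₂ eq))

maxLetter : ∀ {n} → Bool → SV (suc n)
maxLetter {n} ε = ε , fromℕ n

-- c = just i gives σ(i) = ±(n+1) and σ(n+1) = w(i); c = nothing gives σ(n+1) = ±(n+1).
insertMax : ∀ {n} → Word n → Maybe (Fin n) → Bool → Word (suc n)
insertMax w nothing  ε = Vec.map injectLetter w ∷ʳ maxLetter ε
insertMax w (just i) ε = (Vec.map injectLetter w [ i ]≔ maxLetter ε) ∷ʳ injectLetter (lookup w i)

maxPosition : ∀ {n} → Maybe (Fin n) → Fin (suc n)
maxPosition nothing  = fromℕ _
maxPosition (just i) = inject₁ i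

oldPosition : ∀ {n} → Maybe (Fin n) → Fin n → Fin (suc n)
oldPosition nothing  p = inject₁ p
oldPosition (just i) p = if ⌊ p ≟ i ⌋ then fromℕ _ else inject₁ p

oldPosition-self : ∀ {n} (i : Fin n) → oldPosition (just i) i ≡ fromℕ n
oldPosition-self i with i ≟ i
... | yes _  = refl
... | no i≢i = contradiction refl i≢i

oldPosition-≢ : ∀ {n} {i p : Fin n} → p ≢ i → oldPosition (just i) p ≡ inject₁ p
oldPosition-≢ {i = i} {p} p≢i with p ≟ i
... | yes p≡i = contradiction p≡i p≢i
... | no _    = refl

data Position {n} (c : Maybe (Fin n)) : Fin (suc n) → Set where
  max : Position c (maxPosition c)
  old : ∀ p → Position c (oldPosition c p)

data Inject₁OrLast {n} : Fin (suc n) → Set where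
  inject : ∀ b → Inject₁OrLast (inject₁ b)
  last   : Inject₁OrLast (fromℕ n)

inject₁OrLast : ∀ {n} (k : Fin (suc n)) → Inject₁OrLast k
inject₁OrLast {ℕ.zero} zero    = last
inject₁OrLast {suc n}  zero    = inject zero
inject₁OrLast {suc n}  (suc k) with inject₁OrLast k
... | inject b = inject (suc b)
... | last     = last

position : ∀ {n} (c : Maybe (Fin n)) k → Position c k
position nothing  k with inject₁OrLast k
... | inject b = old b
... | last     = max
position (just i) k with inject₁OrLast k
... | last     = subst (Position (just i)) (oldPosition-self i) (old i)
... | inject b with b ≟ i
...   | yes refl = max
...   | no b≢i   = subst (Position (just i)) (oldPosition-≢ b≢i) (old b)

maxPosition-injective : ∀ {n} {c c′ : Maybe (Fin n)} → maxPosition c ≡ maxPosition c′ → c ≡ c′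
maxPosition-injective {c = nothing} {nothing} _  = refl
maxPosition-injective {c = nothing} {just _}  eq = contradiction eq fromℕ≢inject₁
maxPosition-injective {c = just _}  {nothing} eq = contradiction (sym eq) fromℕ≢inject₁
maxPosition-injective {c = just _}  {just _}  eq = cong just (inject₁-injective eq)

maxPosition-surjective : ∀ {n} (m : Fin (suc n)) → ∃[ c ] maxPosition c ≡ m
maxPosition-surjective m with inject₁OrLast m
... | inject b = just b , refl
... | last     = nothing , refl

oldPosition-injective : ∀ {n} {c : Maybe (Fin n)} {p q} → oldPosition c p ≡ oldPosition c q → p ≡ q
oldPosition-injective {c = nothing} eq = inject₁-injective eq
oldPosition-injective {c = just i} {p} {q} eq with p ≟ i | q ≟ i
... | yes refl | yes refl = refl
... | yes refl | no _     = contradiction eq fromℕ≢inject₁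
... | no _     | yes refl = contradiction (sym eq) fromℕ≢inject₁
... | no _     | no _     = inject₁-injective eq

maxPosition≢oldPosition : ∀ {n} (c : Maybe (Fin n)) p → maxPosition c ≢ oldPosition c p
maxPosition≢oldPosition nothing  p eq = fromℕ≢inject₁ eq
maxPosition≢oldPosition (just i) p eq with p ≟ i
... | yes refl = fromℕ≢inject₁ (sym eq)
... | no p≢i   = p≢i (sym (inject₁-injective eq))

module _ {n} (w : Word n) where

  private
    ŵ = Vec.map injectLetter w

  lookup-insertMax-max : ∀ c ε → lookup (insertMax w c ε) (maxPosition c) ≡ maxLetter ε
  lookup-insertMax-max nothing  ε = lookup-∷ʳ-fromℕ ŵ _
  lookup-insertMax-max (just i) ε = trans (lookup-∷ʳ-inject₁ (ŵ [ i ]≔ maxLetter ε) _ i) (lookup∘update i ŵ (maxLetter ε))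

  lookup-insertMax-old : ∀ c ε p → lookup (insertMax w c ε) (oldPosition c p) ≡ injectLetter (lookup w p)
  lookup-insertMax-old nothing  ε p = trans (lookup-∷ʳ-inject₁ ŵ (maxLetter ε) p) (lookup-map p injectLetter w)
  lookup-insertMax-old (just i) ε p with p ≟ i
  ... | yes refl = lookup-∷ʳ-fromℕ (ŵ [ p ]≔ maxLetter ε) _
  ... | no p≢i   = begin
    lookup ((ŵ [ i ]≔ maxLetter ε) ∷ʳ _) (inject₁ p) ≡⟨ lookup-∷ʳ-inject₁ (ŵ [ i ]≔ maxLetter ε) _ p ⟩
    lookup (ŵ [ i ]≔ maxLetter ε) p                   ≡⟨ lookup∘update′ p≢i ŵ (maxLetter ε) ⟩
    lookup ŵ p                                        ≡⟨ lookup-map p injectLetter w ⟩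
    injectLetter (lookup w p)                         ∎
    where open ≡-Reasoning

  absP-insertMax-max : ∀ c ε → absP (insertMax w c ε) (maxPosition c) ≡ fromℕ n
  absP-insertMax-max c ε = cong proj₂ (lookup-insertMax-max c ε)

  absP-insertMax-old : ∀ c ε p → absP (insertMax w c ε) (oldPosition c p) ≡ inject₁ (absP w p)
  absP-insertMax-old c ε p = cong proj₂ (lookup-insertMax-old c ε p)

  module _ (c : Maybe (Fin n)) (ε : Bool) where

    private
      u = insertMax w c ε

    absP-insertMax-old≢fromℕ : ∀ p → absP u (oldPosition c p) ≢ fromℕ n
    absP-insertMax-old≢fromℕ p eq = fromℕ≢inject₁ (trans (sym eq) (absP-insertMax-old c ε p))

    insertMax-isSignedPerm : IsSignedPerm w → IsSignedPerm u
    insertMax-isSignedPerm inj {k} {l} = go (position c k) (position c l)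
      where
      go : ∀ {k l} → Position c k → Position c l → absP u k ≡ absP u l → k ≡ l
      go max     max     _  = refl
      go max     (old q) eq = contradiction (trans (sym eq) (absP-insertMax-max c ε)) (absP-insertMax-old≢fromℕ q)
      go (old p) max     eq = contradiction (trans eq (absP-insertMax-max c ε)) (absP-insertMax-old≢fromℕ p)
      go (old p) (old q) eq = cong (oldPosition c) (inj (inject₁-injective
        (trans (sym (absP-insertMax-old c ε p)) (trans eq (absP-insertMax-old c ε q)))))

    insertMax-isSignedPerm⁻ : IsSignedPerm u → IsSignedPerm w
    insertMax-isSignedPerm⁻ inj {p} {q} eq = oldPosition-injective {c = c} (inj
      (trans (absP-insertMax-old c ε p) (trans (cong inject₁ eq) (sym (absP-insertMax-old c ε q)))))

insertMax-injective : ∀ {n} {w w′ : Word n} {c c′ ε ε′} → insertMax w c ε ≡ insertMax w′ c′ ε′ →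
                      w ≡ w′ × c ≡ c′ × ε ≡ ε′
insertMax-injective {n} {w} {w′} {c} {c′} {ε} {ε′} eq with sameChoice (position c (maxPosition c′)) refl
  where
  sameChoice : ∀ {k} → Position c k → k ≡ maxPosition c′ → c ≡ c′
  sameChoice max     k≡ = maxPosition-injective k≡
  sameChoice (old p) k≡ = contradiction (begin
    absP (insertMax w c ε) (oldPosition c p)     ≡⟨ cong (λ v → absP v (oldPosition c p)) eq ⟩
    absP (insertMax w′ c′ ε′) (oldPosition c p)  ≡⟨ cong (absP (insertMax w′ c′ ε′)) k≡ ⟩
    absP (insertMax w′ c′ ε′) (maxPosition c′)   ≡⟨ absP-insertMax-max w′ c′ ε′ ⟩
    fromℕ n                                      ∎) (absP-insertMax-old≢fromℕ w c ε p)
    where open ≡-Reasoning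
... | refl = lookup-ext sameLetter , refl , cong proj₁ sameMax
  where
  sameLetter : ∀ p → lookup w p ≡ lookup w′ p
  sameLetter p = injectLetter-injective (trans (sym (lookup-insertMax-old w c ε p))
    (trans (cong (λ v → lookup v (oldPosition c p)) eq) (lookup-insertMax-old w′ c ε′ p)))
  sameMax : maxLetter {n} ε ≡ maxLetter ε′
  sameMax = trans (sym (lookup-insertMax-max w c ε))
    (trans (cong (λ v → lookup v (maxPosition c)) eq) (lookup-insertMax-max w′ c ε′))

lowerLetter : ∀ {n} (a : SV (suc n)) → proj₂ a ≢ fromℕ n → SV n
lowerLetter {n} (ε , k) k≢n = ε , lower₁ k (λ n≡k → k≢n (toℕ-injective (trans (sym n≡k) (sym (toℕ-fromℕ n)))))

injectLetter-lowerLetter : ∀ {n} (a : SV (suc n)) (a≢n : proj₂ a ≢ fromℕ n) → injectLetter (lowerLetter a a≢n) ≡ a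
injectLetter-lowerLetter (ε , k) _ = cong (ε ,_) (inject₁-lower₁ k _)

insertMax-surjective : ∀ {n} (u : Word (suc n)) → IsSignedPerm u →
                       ∃[ w ] ∃[ c ] ∃[ ε ] insertMax w c ε ≡ u
insertMax-surjective {n} u inj
  with m , uₘ≡n ← hasPreimage inj (fromℕ n)
  with c , refl ← maxPosition-surjective m
  = w , c , ε , lookup-ext agree
  where
  old≢n : ∀ p → absP u (oldPosition c p) ≢ fromℕ n
  old≢n p eq = maxPosition≢oldPosition c p (inj (trans uₘ≡n (sym eq)))
  w : Word n
  w = Vec.tabulate (λ p → lowerLetter (lookup u (oldPosition c p)) (old≢n p))
  ε : Bool
  ε = proj₁ (lookup u (maxPosition c))
  agreeAt : ∀ {k} → Position c k → lookup (insertMax w c ε) k ≡ lookup u k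
  agreeAt max     = trans (lookup-insertMax-max w c ε) (cong (ε ,_) (sym uₘ≡n))
  agreeAt (old p) = begin
    lookup (insertMax w c ε) (oldPosition c p)                    ≡⟨ lookup-insertMax-old w c ε p ⟩
    injectLetter (lookup w p)                                     ≡⟨ cong injectLetter (lookup∘tabulate _ p) ⟩
    injectLetter (lowerLetter (lookup u (oldPosition c p)) (old≢n p)) ≡⟨ injectLetter-lowerLetter _ (old≢n p) ⟩
    lookup u (oldPosition c p)                                    ∎
    where open ≡-Reasoning
  agree : ∀ k → lookup (insertMax w c ε) k ≡ lookup u k
  agree k = agreeAt (position c k)

module _ {a ℓ} (M : CommutativeMonoid a ℓ) where
  open CommutativeMonoid M renaming (Carrier to A; refl to ≈-refl; sym to ≈-sym; trans to ≈-trans)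
  open Summation M
  open import Relation.Binary.Reasoning.Setoid setoid

  ∑-insertMax : ∀ {n} (φ : SV (suc n) → A) (w : Word n) c ε →
                ∑ (φ ∘ lookup (insertMax w c ε)) ≈ ∑ (φ ∘ injectLetter ∘ lookup w) ∙ φ (maxLetter ε)
  ∑-insertMax {n} φ w c ε = ≈-trans (∑-init-last (φ ∘ lookup (insertMax w c ε))) (split c)
    where
    split : ∀ c → let u = insertMax w c ε in
            ∑ (φ ∘ lookup u ∘ inject₁) ∙ φ (lookup u (fromℕ n))
            ≈ ∑ (φ ∘ injectLetter ∘ lookup w) ∙ φ (maxLetter ε)
    split nothing  = ∙-cong (∑-cong (λ b → reflexive (≡.cong φ (lookup-insertMax-old w nothing ε b))))
                            (reflexive (≡.cong φ (lookup-insertMax-max w nothing ε)))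
    split (just i) = begin
      ∑ (φ ∘ lookup u ∘ inject₁) ∙ φ (lookup u (fromℕ n))          ≈⟨ ∙-congˡ (reflexive (≡.cong φ uₙ≡wᵢ)) ⟩
      ∑ (φ ∘ lookup u ∘ inject₁) ∙ φ (injectLetter (lookup w i))   ≈⟨ ∑-exchange i unchanged ⟩
      ∑ (φ ∘ injectLetter ∘ lookup w) ∙ φ (lookup u (inject₁ i))   ≈⟨ ∙-congˡ (reflexive (≡.cong φ uᵢ≡max)) ⟩
      ∑ (φ ∘ injectLetter ∘ lookup w) ∙ φ (maxLetter ε)            ∎
      where
      u = insertMax w (just i) ε
      uₙ≡wᵢ : lookup u (fromℕ n) ≡ injectLetter (lookup w i)
      uₙ≡wᵢ = ≡.trans (≡.cong (lookup u) (≡.sym (oldPosition-self i))) (lookup-insertMax-old w (just i) ε i)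
      uᵢ≡max : lookup u (inject₁ i) ≡ maxLetter ε
      uᵢ≡max = lookup-insertMax-max w (just i) ε
      unchanged : ∀ b → b ≢ i → φ (lookup u (inject₁ b)) ≈ φ (injectLetter (lookup w b))
      unchanged b b≢i = reflexive (≡.cong φ
        (≡.trans (≡.cong (lookup u) (≡.sym (oldPosition-≢ b≢i))) (lookup-insertMax-old w (just i) ε b)))

indicator : Bool → ℕ
indicator b = if b then 1 else 0

countᵇ≡sum : ∀ {A : Set} (p : A → Bool) xs → countᵇ p xs ≡ sum (map (indicator ∘ p) xs)
countᵇ≡sum p []       = refl
countᵇ≡sum p (x ∷ xs) with p x
... | true  = cong suc (countᵇ≡sum p xs)
... | false = countᵇ≡sum p xs

module _ {n} (w : Word n) (c : Maybe (Fin n)) (ε : Bool) where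
  open Summation +-0-commutativeMonoid using (∑; ∑-cong)

  private
    u = insertMax w c ε

  neg-insertMax : neg u ≡ neg w ℕ.+ indicator ε
  neg-insertMax = begin
    neg u                                             ≡⟨ countᵇ≡sum _ (allFin (suc n)) ⟩
    ∑ (indicator ∘ proj₁ ∘ lookup u)                  ≡⟨ ∑-insertMax +-0-commutativeMonoid (indicator ∘ proj₁) w c ε ⟩
    ∑ (indicator ∘ proj₁ ∘ lookup w) ℕ.+ indicator ε  ≡⟨ cong (ℕ._+ indicator ε) (countᵇ≡sum _ (allFin n)) ⟨
    neg w ℕ.+ indicator ε                             ∎
    where open ≡-Reasoning

  nsum-insertMax : nsum u ≡ nsum w ℕ.+ (if ε then suc n else 0)
  nsum-insertMax = trans (∑-insertMax +-0-commutativeMonoid value w c ε)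
    (cong₂ ℕ._+_ (∑-cong (λ b → value-injectLetter (lookup w b))) (value-max ε))
    where
    value : ∀ {m} → SV m → ℕ
    value (b , k) = if b then suc (toℕ k) else 0
    value-injectLetter : ∀ {m} (a : SV m) → value (injectLetter a) ≡ value a
    value-injectLetter (true  , k) = cong suc (toℕ-inject₁ k)
    value-injectLetter (false , k) = refl
    value-max : ∀ ε → value (maxLetter {n} ε) ≡ (if ε then suc n else 0)
    value-max true  = cong suc (toℕ-fromℕ n)
    value-max false = refl

absP-insertMax-inject₁ : ∀ {n} (w : Word n) c ε b → let π⁺ = absP (insertMax w c ε) in
  π⁺ (inject₁ b) ≡ inject₁ (absP w b) ⊎ (π⁺ (inject₁ b) ≡ fromℕ n × π⁺ (fromℕ n) ≡ inject₁ (absP w b))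
absP-insertMax-inject₁ w nothing  ε b = inj₁ (absP-insertMax-old w nothing ε b)
absP-insertMax-inject₁ w (just i) ε b with b ≟ i
... | yes refl = inj₂ (absP-insertMax-max w (just b) ε ,
  trans (cong (absP (insertMax w (just b) ε)) (sym (oldPosition-self b))) (absP-insertMax-old w (just b) ε b))
... | no b≢i   = inj₁
  (trans (cong (absP (insertMax w (just i) ε)) (sym (oldPosition-≢ b≢i))) (absP-insertMax-old w (just i) ε b))

module _ {n} {w : Word n} (inj : IsSignedPerm w) where
  open Summation +-0-commutativeMonoid using (∑; ∑-cong; ∑-init-last)

  isCycleMin-insertMax-inject₁ : ∀ c ε b → isCycleMin (absP (insertMax w c ε)) (inject₁ b) ≡ isCycleMin (absP w) b
  isCycleMin-insertMax-inject₁ c ε b = T-injective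
    (from (isCycleMin⇔IsCycleMin inj b) ∘ to (IsCycleMin-inject₁ b) ∘ to (isCycleMin⇔IsCycleMin inj⁺ (inject₁ b)))
    (from (isCycleMin⇔IsCycleMin inj⁺ (inject₁ b)) ∘ from (IsCycleMin-inject₁ b) ∘ to (isCycleMin⇔IsCycleMin inj b))
    where
    open Splice (absP w) (absP (insertMax w c ε)) (absP-insertMax-inject₁ w c ε)
    open Equivalence
    inj⁺ = insertMax-isSignedPerm w c ε inj

  isCycleMin-insertMax-max : ∀ c ε → isCycleMin (absP (insertMax w c ε)) (fromℕ n) ≡ not (is-just c)
  isCycleMin-insertMax-max nothing ε = T-injective (λ _ → _) λ _ →
    Equivalence.from (isCycleMin⇔IsCycleMin (insertMax-isSignedPerm w nothing ε inj) (fromℕ n))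
      (λ r → subst (λ k → toℕ (fromℕ n) ≤ toℕ k) (sym (iter-fixed (absP-insertMax-max w nothing ε) r)) ≤-refl)
  isCycleMin-insertMax-max (just i) ε = T-injective notMin λ ()
    where
    π⁺ = absP (insertMax w (just i) ε)
    π⁺n≡πi : π⁺ (fromℕ n) ≡ inject₁ (absP w i)
    π⁺n≡πi = trans (cong π⁺ (sym (oldPosition-self i))) (absP-insertMax-old w (just i) ε i)
    notMin : T (isCycleMin π⁺ (fromℕ n)) → T false
    notMin t = <⇒≱ (subst₂ _<_ (sym (cong toℕ π⁺n≡πi)) (sym (toℕ-fromℕ n)) (inject₁ℕ< (absP w i)))
      (Equivalence.to (isCycleMin⇔IsCycleMin (insertMax-isSignedPerm w (just i) ε inj) (fromℕ n)) t 1)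

  cyc-insertMax : ∀ c ε → cyc (insertMax w c ε) ≡ cyc w ℕ.+ indicator (not (is-just c))
  cyc-insertMax c ε = begin
    cyc u                                                 ≡⟨ countᵇ≡sum _ (allFin (suc n)) ⟩
    ∑ (indicator ∘ min⁺)                                  ≡⟨ ∑-init-last (indicator ∘ min⁺) ⟩
    ∑ (indicator ∘ min⁺ ∘ inject₁) ℕ.+ indicator (min⁺ (fromℕ n))
      ≡⟨ cong₂ ℕ._+_ (∑-cong (cong indicator ∘ isCycleMin-insertMax-inject₁ c ε))
                     (cong indicator (isCycleMin-insertMax-max c ε)) ⟩
    ∑ (indicator ∘ isCycleMin (absP w)) ℕ.+ indicator (not (is-just c))
      ≡⟨ cong (ℕ._+ _) (countᵇ≡sum _ (allFin n)) ⟨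
    cyc w ℕ.+ indicator (not (is-just c))                 ∎
    where
    open ≡-Reasoning
    u = insertMax w c ε
    min⁺ = isCycleMin (absP u)

-- excCond w p is excTest (w p) (w |w p|), the test whether |w p| ∈ EXC_B(w).
excTest : ∀ {n} → SV n → SV n → Bool
excTest a v = (proj₁ v ∧ ⌊ proj₂ v ≟ proj₂ a ⌋) ∨ ⌊ sval a ℤ.<? sval v ⌋

sval-injectLetter : ∀ {n} (a : SV n) → sval (injectLetter a) ≡ sval a
sval-injectLetter (true  , k) = cong (λ m → ℤ.- (ℤ.+ suc m)) (toℕ-inject₁ k)
sval-injectLetter (false , k) = cong (λ m → ℤ.+ suc m) (toℕ-inject₁ k)

sval-maxLetter-true : ∀ n → sval (maxLetter {n} true) ≡ -[1+ n ]
sval-maxLetter-true n = cong -[1+_] (toℕ-fromℕ n)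

sval-maxLetter-false : ∀ n → sval (maxLetter {n} false) ≡ ℤ.+ suc n
sval-maxLetter-false n = cong (λ m → ℤ.+ suc m) (toℕ-fromℕ n)

sval<+[1+n] : ∀ {n} (a : SV n) → sval a ℤ.< ℤ.+ suc n
sval<+[1+n] (true  , k) = -<+
sval<+[1+n] (false , k) = +<+ (s≤s (toℕ<n k))

-[1+n]<sval : ∀ {n} (a : SV n) → -[1+ n ] ℤ.< sval a
-[1+n]<sval (true  , k) = -<- (toℕ<n k)
-[1+n]<sval (false , k) = -<+

excTest-injectLetter : ∀ {n} (a v : SV n) → excTest (injectLetter a) (injectLetter v) ≡ excTest a v
excTest-injectLetter a v = cong₂ (λ e lt → (proj₁ v ∧ e) ∨ lt) same≟ same<
  where
  same≟ : ⌊ inject₁ (proj₂ v) ≟ inject₁ (proj₂ a) ⌋ ≡ ⌊ proj₂ v ≟ proj₂ a ⌋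
  same≟ = T-injective (λ t → fromWitness (inject₁-injective (toWitness t))) (λ t → fromWitness (cong inject₁ (toWitness t)))
  same< : ⌊ sval (injectLetter a) ℤ.<? sval (injectLetter v) ⌋ ≡ ⌊ sval a ℤ.<? sval v ⌋
  same< = cong₂ (λ x y → ⌊ x ℤ.<? y ⌋) (sval-injectLetter a) (sval-injectLetter v)

excTest-injectLetter-max : ∀ {n} (a : SV n) ε → excTest (injectLetter a) (maxLetter ε) ≡ not ε
excTest-injectLetter-max {n} a ε = begin
  (ε ∧ ⌊ fromℕ n ≟ inject₁ (proj₂ a) ⌋) ∨ ⌊ sval (injectLetter a) ℤ.<? sval (maxLetter ε) ⌋
    ≡⟨ cong₂ _∨_ (trans (cong (ε ∧_) (isYes-false _ fromℕ≢inject₁)) (∧-zeroʳ ε))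
                 (cong (λ x → ⌊ x ℤ.<? sval (maxLetter ε) ⌋) (sval-injectLetter a)) ⟩
  ⌊ sval a ℤ.<? sval (maxLetter ε) ⌋
    ≡⟨ below ε ⟩
  not ε ∎
  where
  open ≡-Reasoning
  below : ∀ ε → ⌊ sval a ℤ.<? sval (maxLetter {n} ε) ⌋ ≡ not ε
  below true  = isYes-false _ (λ a<m → ℤ.<-asym a<m (subst (ℤ._< sval a) (sym (sval-maxLetter-true n)) (-[1+n]<sval a)))
  below false = isYes-true _ (subst (sval a ℤ.<_) (sym (sval-maxLetter-false n)) (sval<+[1+n] a))

excTest-max-injectLetter : ∀ {n} ε (v : SV n) → excTest (maxLetter ε) (injectLetter v) ≡ ε
excTest-max-injectLetter {n} ε v = begin
  (proj₁ v ∧ ⌊ inject₁ (proj₂ v) ≟ fromℕ n ⌋) ∨ ⌊ sval (maxLetter ε) ℤ.<? sval (injectLetter v) ⌋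
    ≡⟨ cong₂ _∨_ (trans (cong (proj₁ v ∧_) (isYes-false _ (λ eq → fromℕ≢inject₁ (sym eq)))) (∧-zeroʳ (proj₁ v)))
                 (cong (λ x → ⌊ sval (maxLetter ε) ℤ.<? x ⌋) (sval-injectLetter v)) ⟩
  ⌊ sval (maxLetter ε) ℤ.<? sval v ⌋
    ≡⟨ above ε ⟩
  ε ∎
  where
  open ≡-Reasoning
  above : ∀ ε → ⌊ sval (maxLetter {n} ε) ℤ.<? sval v ⌋ ≡ ε
  above true  = isYes-true _ (subst (ℤ._< sval v) (sym (sval-maxLetter-true n)) (-[1+n]<sval v))
  above false = isYes-false _ (λ m<v → ℤ.<-asym m<v (subst (sval v ℤ.<_) (sym (sval-maxLetter-false n)) (sval<+[1+n] v)))

excTest-max-max : ∀ {n} ε → excTest (maxLetter {n} ε) (maxLetter ε) ≡ ε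
excTest-max-max {n} ε = begin
  (ε ∧ ⌊ fromℕ n ≟ fromℕ n ⌋) ∨ ⌊ sval (maxLetter {n} ε) ℤ.<? sval (maxLetter {n} ε) ⌋
    ≡⟨ cong₂ _∨_ (trans (cong (ε ∧_) (isYes-true _ refl)) (∧-identityʳ ε)) (isYes-false _ (ℤ.<-irrefl refl)) ⟩
  ε ∨ false
    ≡⟨ ∨-identityʳ ε ⟩
  ε ∎
  where open ≡-Reasoning

inEXCB-preimage : ∀ {n} (w : Word n) → IsSignedPerm w → ∀ {p j} → absP w p ≡ j →
                  inEXCB w j ≡ excTest (lookup w p) (lookup w j)
inEXCB-preimage {n} w inj {p} refl = T-injective to from
  where
  to : T (inEXCB w (absP w p)) → T (excCond w p)
  to t with i , hit ← satisfied (any⁻ _ (allFin n) t) with i↦j , exc ← Equivalence.to T-∧ hit =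
    subst (T ∘ excCond w) (inj (toWitness i↦j)) exc
  from : T (excCond w p) → T (inEXCB w (absP w p))
  from exc = any⁺ _ (lose (∈-allFin p) (Equivalence.from T-∧ (fromWitness refl , exc)))

module _ {n} (w : Word n) (inj : IsSignedPerm w) where

  private
    inj⁺ : ∀ c ε → IsSignedPerm (insertMax w c ε)
    inj⁺ c ε = insertMax-isSignedPerm w c ε inj

  inEXCB-insertMax-old : ∀ c ε j → oldPosition c j ≡ inject₁ j → inEXCB (insertMax w c ε) (inject₁ j) ≡ inEXCB w j
  inEXCB-insertMax-old c ε j old≡ with p , πp≡j ← hasPreimage inj j = begin
    inEXCB u (inject₁ j)
      ≡⟨ inEXCB-preimage u (inj⁺ c ε) (trans (absP-insertMax-old w c ε p) (cong inject₁ πp≡j)) ⟩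
    excTest (lookup u (oldPosition c p)) (lookup u (inject₁ j))
      ≡⟨ cong₂ excTest (lookup-insertMax-old w c ε p) (trans (cong (lookup u) (sym old≡)) (lookup-insertMax-old w c ε j)) ⟩
    excTest (injectLetter (lookup w p)) (injectLetter (lookup w j))
      ≡⟨ excTest-injectLetter (lookup w p) (lookup w j) ⟩
    excTest (lookup w p) (lookup w j)
      ≡⟨ inEXCB-preimage w inj πp≡j ⟨
    inEXCB w j ∎
    where
    open ≡-Reasoning
    u = insertMax w c ε

  inEXCB-insertMax-new : ∀ i ε → inEXCB (insertMax w (just i) ε) (inject₁ i) ≡ not ε
  inEXCB-insertMax-new i ε with p , πp≡i ← hasPreimage inj i = begin
    inEXCB u (inject₁ i)
      ≡⟨ inEXCB-preimage u (inj⁺ (just i) ε) (trans (absP-insertMax-old w (just i) ε p) (cong inject₁ πp≡i)) ⟩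
    excTest (lookup u (oldPosition (just i) p)) (lookup u (inject₁ i))
      ≡⟨ cong₂ excTest (lookup-insertMax-old w (just i) ε p) (lookup-insertMax-max w (just i) ε) ⟩
    excTest (injectLetter (lookup w p)) (maxLetter ε)
      ≡⟨ excTest-injectLetter-max (lookup w p) ε ⟩
    not ε ∎
    where
    open ≡-Reasoning
    u = insertMax w (just i) ε

  inEXCB-insertMax-max : ∀ c ε → inEXCB (insertMax w c ε) (fromℕ n) ≡ ε
  inEXCB-insertMax-max c ε = begin
    inEXCB u (fromℕ n)
      ≡⟨ inEXCB-preimage u (inj⁺ c ε) (absP-insertMax-max w c ε) ⟩
    excTest (lookup u (maxPosition c)) (lookup u (fromℕ n))
      ≡⟨ cong (λ a → excTest a (lookup u (fromℕ n))) (lookup-insertMax-max w c ε) ⟩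
    excTest (maxLetter ε) (lookup u (fromℕ n))
      ≡⟨ atLast c ⟩
    ε ∎
    where
    open ≡-Reasoning
    u = insertMax w c ε
    atLast : ∀ c → excTest (maxLetter ε) (lookup (insertMax w c ε) (fromℕ n)) ≡ ε
    atLast nothing  = trans (cong (excTest (maxLetter ε)) (lookup-insertMax-max w nothing ε)) (excTest-max-max ε)
    atLast (just i) = trans (cong (excTest (maxLetter ε))
      (trans (cong (lookup (insertMax w (just i) ε)) (sym (oldPosition-self i))) (lookup-insertMax-old w (just i) ε i)))
      (excTest-max-injectLetter ε (lookup w i))

concatMap-map≡cartesianProductWith : ∀ {A B C : Set} (f : A → B → C) xs ys →
  concatMap (λ x → map (f x) ys) xs ≡ cartesianProductWith f xs ys
concatMap-map≡cartesianProductWith f []       ys = refl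
concatMap-map≡cartesianProductWith f (x ∷ xs) ys = cong (map (f x) ys ++_) (concatMap-map≡cartesianProductWith f xs ys)

module _ {A : Set} (xs : List A) where

  allVecs-suc : ∀ k → allVecs xs (suc k) ≡ cartesianProductWith _∷_ xs (allVecs xs k)
  allVecs-suc k = concatMap-map≡cartesianProductWith _∷_ xs (allVecs xs k)

  allVecs-unique : Unique xs → ∀ k → Unique (allVecs xs k)
  allVecs-unique u zero    = All.[] ∷ []
  allVecs-unique u (suc k) = subst Unique (sym (allVecs-suc k))
    (Unique.cartesianProductWith⁺ _∷_ ∷-injective u (allVecs-unique u k))

  allVecs-complete : (∀ a → a ∈ xs) → ∀ {k} (v : Vec A k) → v ∈ allVecs xs k
  allVecs-complete complete []       = here refl
  allVecs-complete complete (a ∷ v) = subst (_ ∈_) (sym (allVecs-suc _))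
    (∈-cartesianProductWith⁺ _∷_ (complete a) (allVecs-complete complete v))

bools : List Bool
bools = true ∷ false ∷ []

bools-unique : Unique bools
bools-unique = ((λ ()) All.∷ All.[]) ∷ All.[] ∷ []

bools-complete : ∀ b → b ∈ bools
bools-complete true  = here refl
bools-complete false = there (here refl)

allSV-unique : ∀ n → Unique (allSV n)
allSV-unique n = subst Unique (sym (concatMap-map≡cartesianProductWith _,_ bools (allFin n)))
  (Unique.cartesianProduct⁺ bools-unique (Unique.allFin⁺ n))

allSV-complete : ∀ n (a : SV n) → a ∈ allSV n
allSV-complete n (b , k) = subst (_ ∈_) (sym (concatMap-map≡cartesianProductWith _,_ bools (allFin n)))
  (∈-cartesianProduct⁺ (bools-complete b) (∈-allFin k))

isSignedPerm⇔IsSignedPerm : ∀ {n} (w : Word n) → T (isSignedPerm w) ⇔ IsSignedPerm w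
isSignedPerm⇔IsSignedPerm {n} w = mk⇔ to from
  where
  test : Fin n → Fin n → Bool
  test i j = not ⌊ absP w i ≟ absP w j ⌋ ∨ ⌊ i ≟ j ⌋
  row : Fin n → Bool
  row i = all (test i) (allFin n)
  to : T (isSignedPerm w) → IsSignedPerm w
  to t {i} {j} eq = toWitness (modusPonens (isYes-true (absP w i ≟ absP w j) eq) entry)
    where
    modusPonens : ∀ {a b} → a ≡ true → T (not a ∨ b) → T b
    modusPonens refl tb = tb
    entry : T (test i j)
    entry = All.lookup (all⁺ (test i) (allFin n) (All.lookup (all⁺ row (allFin n) t) (∈-allFin i))) (∈-allFin j)
  from : IsSignedPerm w → T (isSignedPerm w)
  from inj = all⁻ row {allFin n} (All.tabulate λ {i} _ →
    all⁻ (test i) {allFin n} (All.tabulate λ {j} _ → testHolds i j))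
    where
    testHolds : ∀ i j → T (test i j)
    testHolds i j with absP w i ≟ absP w j
    ... | yes eq = fromWitness (inj eq)
    ... | no _   = _

Bn-unique : ∀ n → Unique (Bn n)
Bn-unique n = Unique.filter⁺ (T? ∘ isSignedPerm) (allVecs-unique (allSV n) (allSV-unique n) n)

∈-Bn⇔IsSignedPerm : ∀ {n} (w : Word n) → w ∈ Bn n ⇔ IsSignedPerm w
∈-Bn⇔IsSignedPerm {n} w = mk⇔
  (to ∘ proj₂ ∘ ∈-filter⁻ (T? ∘ isSignedPerm) {xs = allVecs (allSV n) n})
  (∈-filter⁺ (T? ∘ isSignedPerm) (allVecs-complete (allSV n) (allSV-complete n) w) ∘ from)
  where open Equivalence (isSignedPerm⇔IsSignedPerm w)

choices : ∀ n → List (Maybe (Fin n) × Bool)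
choices n = cartesianProduct (nothing ∷ map just (allFin n)) bools

choices-unique : ∀ n → Unique (choices n)
choices-unique n = Unique.cartesianProduct⁺ (All.tabulate nothing≢ ∷ Unique.map⁺ just-injective (Unique.allFin⁺ n)) bools-unique
  where
  nothing≢ : ∀ {c} → c ∈ map just (allFin n) → nothing ≢ c
  nothing≢ c∈ with _ , _ , refl ← ∈-map⁻ just c∈ = λ ()

choices-complete : ∀ n c → c ∈ choices n
choices-complete n (c , ε) = ∈-cartesianProduct⁺ (complete c) (bools-complete ε)
  where
  complete : ∀ c → c ∈ nothing ∷ map just (allFin n)
  complete nothing  = here refl
  complete (just i) = there (∈-map⁺ just (∈-allFin i))

insertMax′ : ∀ {n} → Word n × Maybe (Fin n) × Bool → Word (suc n)
insertMax′ (w , c , ε) = insertMax w c ε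

Bn-suc↭ : ∀ n → Bn (suc n) ↭ map insertMax′ (cartesianProduct (Bn n) (choices n))
Bn-suc↭ n = ∼bag⇒↭ (unique∧set⇒bag (Bn-unique (suc n))
  (Unique.map⁺ injective (Unique.cartesianProduct⁺ (Bn-unique n) (choices-unique n))) (mk⇔ to from))
  where
  injective : ∀ {x y} → insertMax′ x ≡ insertMax′ y → x ≡ y
  injective {w , c , ε} {w′ , c′ , ε′} eq
    with refl , refl , refl ← insertMax-injective {w = w} {w′} {c} {c′} {ε} {ε′} eq = refl
  to : ∀ {u} → u ∈ Bn (suc n) → u ∈ map insertMax′ (cartesianProduct (Bn n) (choices n))
  to {u} u∈ with u-perm ← Equivalence.to (∈-Bn⇔IsSignedPerm u) u∈
    with w , c , ε , refl ← insertMax-surjective u u-perm =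
    ∈-map⁺ insertMax′ (∈-cartesianProduct⁺
      (Equivalence.from (∈-Bn⇔IsSignedPerm w) (insertMax-isSignedPerm⁻ w c ε u-perm)) (choices-complete n (c , ε)))
  from : ∀ {u} → u ∈ map insertMax′ (cartesianProduct (Bn n) (choices n)) → u ∈ Bn (suc n)
  from u∈ with (w , c , ε) , x∈ , refl ← ∈-map⁻ insertMax′ u∈ =
    Equivalence.from (∈-Bn⇔IsSignedPerm _) (insertMax-isSignedPerm w c ε
      (Equivalence.to (∈-Bn⇔IsSignedPerm w) (proj₁ (∈-cartesianProduct⁻ (Bn n) (choices n) x∈))))

triangle : ℕ → ℕ
triangle k = (k ℕ.* (k ℕ.+ 1)) ℕ./ 2

triangle-suc : ∀ k → triangle (suc k) ≡ triangle k ℕ.+ suc k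
triangle-suc k = begin
  (suc k ℕ.* (suc k ℕ.+ 1)) ℕ./ 2            ≡⟨ cong (ℕ._/ 2) expand ⟩
  (k ℕ.* (k ℕ.+ 1) ℕ.+ suc k ℕ.* 2) ℕ./ 2    ≡⟨ +-distrib-/-∣ʳ (k ℕ.* (k ℕ.+ 1)) (divides (suc k) refl) ⟩
  triangle k ℕ.+ (suc k ℕ.* 2) ℕ./ 2         ≡⟨ cong (triangle k ℕ.+_) (m*n/n≡m (suc k) 2) ⟩
  triangle k ℕ.+ suc k                       ∎
  where
  open ≡-Reasoning
  open +-*-Solver
  expand : suc k ℕ.* (suc k ℕ.+ 1) ≡ k ℕ.* (k ℕ.+ 1) ℕ.+ suc k ℕ.* 2
  expand = solve 1 (λ k → (con 1 :+ k) :* ((con 1 :+ k) :+ con 1) := k :* (k :+ con 1) :+ (con 1 :+ k) :* con 2) refl k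

module RingProperties {c ℓ} (R : CommutativeRing c ℓ) where
  open CommutativeRing R renaming (refl to ≈-refl; sym to ≈-sym; trans to ≈-trans) hiding (zero)
  open Summation +-commutativeMonoid using (sumOver)
  private module Π = Summation *-commutativeMonoid

  pow-+ : ∀ a m k → pow R a (m ℕ.+ k) ≈ pow R a m * pow R a k
  pow-+ a zero    k = ≈-sym (*-identityˡ _)
  pow-+ a (suc m) k = ≈-trans (*-congˡ (pow-+ a m k)) (≈-sym (*-assoc _ _ _))

  sumOver-*ˡ : ∀ {A : Set} a (f : A → Carrier) xs → sumOver (λ y → a * f y) xs ≈ a * sumOver f xs
  sumOver-*ˡ a f []       = ≈-sym (zeroʳ a)
  sumOver-*ˡ a f (y ∷ ys) = ≈-trans (+-congˡ (sumOver-*ˡ a f ys)) (≈-sym (distribˡ a _ _))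

  ∏-zero : ∀ {n} (h : Fin n → Carrier) j → h j ≈ 0# → Π.∑ h ≈ 0#
  ∏-zero {suc n} h j hⱼ≈0 = ≈-trans (Π.∑-remove j h) (≈-trans (*-congʳ hⱼ≈0) (zeroˡ _))

module WeightedSum {c ℓ} (R : CommutativeRing c ℓ) (s t : CommutativeRing.Carrier R) where
  open CommutativeRing R renaming (refl to ≈-refl; sym to ≈-sym; trans to ≈-trans) hiding (zero)
  open Summation +-commutativeMonoid
  module Π = Summation *-commutativeMonoid
  open RingProperties R using (pow-+; sumOver-*ˡ; ∏-zero)
  open IntegerCoefficients R using (solve; _:+_; _:*_; :-_; _:=_; con)
  open import Relation.Binary.Reasoning.Setoid setoid

  coefficient : ∀ {n} → Word n → Carrier
  coefficient w = pow R (- 1#) (cyc w) * pow R s (neg w) * pow R t (nsum w)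

  excWeight : ∀ {n} → (Fin n → Carrier) → (Fin n → Carrier) → Word n → Fin n → Carrier
  excWeight x z w j = if inEXCB w j then x j else z j

  -- lhs is the sum of weight x (const 1#) over B_n.
  weight : ∀ {n} → (Fin n → Carrier) → (Fin n → Carrier) → Word n → Carrier
  weight x z w = coefficient w * Π.∑ (excWeight x z w)

  module _ {n} (x z : Fin (suc n) → Carrier) where

    maxFactor : Bool → Carrier
    maxFactor true  = x (fromℕ n) * s * pow R t (suc n)
    maxFactor false = z (fromℕ n)

    maxFactor-spec : ∀ ε → pow R s (indicator ε) * pow R t (if ε then suc n else 0) * (if ε then x (fromℕ n) else z (fromℕ n))
                           ≈ maxFactor ε
    maxFactor-spec true  = solve 3 (λ s T x → s :* con 1ℤ :* T :* x := x :* s :* T) ≈-refl s (pow R t (suc n)) (x (fromℕ n))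
    maxFactor-spec false = solve 1 (λ z → con 1ℤ :* con 1ℤ :* z := z) ≈-refl (z (fromℕ n))

    spliceFactor : Bool → Fin n → Carrier
    spliceFactor ε i = (if ε then z (inject₁ i) else x (inject₁ i)) * maxFactor ε

  module _ {n} (w : Word n) (inj : IsSignedPerm w) (x z : Fin (suc n) → Carrier) where

    weight-insertMax : ∀ c ε → let u = insertMax w c ε in
      weight x z u ≈
      pow R (- 1#) (indicator (not (is-just c))) * (coefficient w * (Π.∑ (excWeight x z u ∘ inject₁) * maxFactor x z ε))
    weight-insertMax c ε = begin
      coefficient u * Π.∑ (excWeight x z u)
        ≈⟨ *-cong coefficient-u (Π.∑-init-last (excWeight x z u)) ⟩
      (A * D) * (B * sᵋ) * (C * tᵋ) * (P * excWeight x z u (fromℕ n))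
        ≡⟨ ≡.cong (λ b → (A * D) * (B * sᵋ) * (C * tᵋ) * (P * (if b then x (fromℕ n) else z (fromℕ n))))
                  (inEXCB-insertMax-max w inj c ε) ⟩
      (A * D) * (B * sᵋ) * (C * tᵋ) * (P * X)
        ≈⟨ solve 8 (λ A D B sᵋ C tᵋ P X → (A :* D) :* (B :* sᵋ) :* (C :* tᵋ) :* (P :* X)
                                          := D :* (A :* B :* C :* (P :* (sᵋ :* tᵋ :* X))))
                   ≈-refl A D B sᵋ C tᵋ P X ⟩
      D * (A * B * C * (P * (sᵋ * tᵋ * X)))
        ≈⟨ *-congˡ (*-congˡ (*-congˡ (maxFactor-spec x z ε))) ⟩
      D * (coefficient w * (P * maxFactor x z ε)) ∎
      where
      u = insertMax w c ε
      A = pow R (- 1#) (cyc w)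
      D = pow R (- 1#) (indicator (not (is-just c)))
      B = pow R s (neg w)
      sᵋ = pow R s (indicator ε)
      C = pow R t (nsum w)
      tᵋ = pow R t (if ε then suc n else 0)
      P = Π.∑ (excWeight x z u ∘ inject₁)
      X = if ε then x (fromℕ n) else z (fromℕ n)
      coefficient-u : coefficient u ≈ (A * D) * (B * sᵋ) * (C * tᵋ)
      coefficient-u = *-cong (*-cong
        (≈-trans (reflexive (≡.cong (pow R (- 1#)) (cyc-insertMax inj c ε))) (pow-+ (- 1#) (cyc w) _))
        (≈-trans (reflexive (≡.cong (pow R s) (neg-insertMax w c ε))) (pow-+ s (neg w) _)))
        (≈-trans (reflexive (≡.cong (pow R t) (nsum-insertMax w c ε))) (pow-+ t (nsum w) _))

    private
      x̂ ẑ : Fin n → Carrier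
      x̂ = x ∘ inject₁
      ẑ = z ∘ inject₁

    weight-insertMax-nothing : ∀ ε → weight x z (insertMax w nothing ε) ≈ - maxFactor x z ε * weight x̂ ẑ w
    weight-insertMax-nothing ε = begin
      weight x z u
        ≈⟨ weight-insertMax nothing ε ⟩
      (- 1# * 1#) * (coefficient w * (Π.∑ (excWeight x z u ∘ inject₁) * M))
        ≈⟨ *-congˡ (*-congˡ (*-congʳ (Π.∑-cong unchanged))) ⟩
      (- 1# * 1#) * (coefficient w * (Π.∑ (excWeight x̂ ẑ w) * M))
        ≈⟨ solve 3 (λ A P M → (:- con 1ℤ :* con 1ℤ) :* (A :* (P :* M)) := :- M :* (A :* P)) ≈-refl (coefficient w) _ M ⟩
      - M * weight x̂ ẑ w ∎
      where
      u = insertMax w nothing ε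
      M = maxFactor x z ε
      unchanged : ∀ j → excWeight x z u (inject₁ j) ≈ excWeight x̂ ẑ w j
      unchanged j = reflexive (≡.cong (λ b → if b then x̂ j else ẑ j) (inEXCB-insertMax-old w inj nothing ε j ≡.refl))

    weight-insertMax-just : ∀ ε i → let κ = const (spliceFactor x z ε i) in
      weight x z (insertMax w (just i) ε) ≈ weight (updateAt x̂ i κ) (updateAt ẑ i κ) w
    weight-insertMax-just ε i = begin
      weight x z u                                                   ≈⟨ weight-insertMax (just i) ε ⟩
      1# * (coefficient w * (Π.∑ (excWeight x z u ∘ inject₁) * M))  ≈⟨ *-identityˡ _ ⟩
      coefficient w * (Π.∑ (excWeight x z u ∘ inject₁) * M)         ≈⟨ *-congˡ (Π.∑-update i unchanged M spliced) ⟩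
      coefficient w * Π.∑ (excWeight x′ z′ w)                        ∎
      where
      u = insertMax w (just i) ε
      M = maxFactor x z ε
      κ = spliceFactor x z ε i
      x′ = updateAt x̂ i (const κ)
      z′ = updateAt ẑ i (const κ)
      unchanged : ∀ j → j ≡.≢ i → excWeight x z u (inject₁ j) ≈ excWeight x′ z′ w j
      unchanged j j≢i = reflexive (≡.cong₂ (λ b (xz : Carrier × Carrier) → if b then proj₁ xz else proj₂ xz)
        (inEXCB-insertMax-old w inj (just i) ε j (oldPosition-≢ j≢i))
        (≡.sym (≡.cong₂ _,_ (updateAt-minimal j i x̂ j≢i) (updateAt-minimal j i ẑ j≢i))))
      spliced : excWeight x z u (inject₁ i) * M ≈ excWeight x′ z′ w i
      spliced = begin
        (if inEXCB u (inject₁ i) then x̂ i else ẑ i) * M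
          ≡⟨ ≡.cong (λ b → (if b then x̂ i else ẑ i) * M) (inEXCB-insertMax-new w inj i ε) ⟩
        (if not ε then x̂ i else ẑ i) * M
          ≡⟨ ≡.cong (_* M) (if-not ε) ⟩
        κ
          ≡⟨ if-eta (inEXCB w i) ⟨
        (if inEXCB w i then κ else κ)
          ≡⟨ ≡.cong₂ (if inEXCB w i then_else_) (updateAt-updates i x̂) (updateAt-updates i ẑ) ⟨
        excWeight x′ z′ w i ∎

  total : ∀ n → (Fin n → Carrier) → (Fin n → Carrier) → Carrier
  total n x z = sumOver (weight x z) (Bn n)

  module _ {n} (x z : Fin (suc n) → Carrier) where

    private
      x̂ ẑ : Fin n → Carrier
      x̂ = x ∘ inject₁
      ẑ = z ∘ inject₁

    spliced : Bool → Fin n → (Fin n → Carrier) → Fin n → Carrier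
    spliced ε i f = updateAt f i (const (spliceFactor x z ε i))

    splicings : ((Fin n → Carrier) → (Fin n → Carrier) → Carrier) → Fin n → Carrier
    splicings F i = F (spliced true i x̂) (spliced true i ẑ) + F (spliced false i x̂) (spliced false i ẑ)

    recurrence : ((Fin n → Carrier) → (Fin n → Carrier) → Carrier) → Carrier
    recurrence F = - (maxFactor x z true + maxFactor x z false) * F x̂ ẑ + ∑ (splicings F)

    recurrence-cong : ∀ {F G} → (∀ x′ z′ → F x′ z′ ≈ G x′ z′) → recurrence F ≈ recurrence G
    recurrence-cong F≈G = +-cong (*-congˡ (F≈G x̂ ẑ))
      (∑-cong (λ i → +-cong (F≈G (spliced true i x̂) (spliced true i ẑ)) (F≈G (spliced false i x̂) (spliced false i ẑ))))

    sumOver-recurrence : ∀ {A : Set} (F : (Fin n → Carrier) → (Fin n → Carrier) → A → Carrier) ys →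
      sumOver (λ y → recurrence (λ x′ z′ → F x′ z′ y)) ys ≈ recurrence (λ x′ z′ → sumOver (F x′ z′) ys)
    sumOver-recurrence F ys = begin
      sumOver (λ y → M * F x̂ ẑ y + ∑ (splicings (Fᵧ y))) ys
        ≈⟨ sumOver-distrib (λ y → M * F x̂ ẑ y) (λ y → ∑ (splicings (Fᵧ y))) ys ⟩
      sumOver (λ y → M * F x̂ ẑ y) ys + sumOver (λ y → ∑ (splicings (Fᵧ y))) ys
        ≈⟨ +-cong (sumOver-*ˡ M (F x̂ ẑ) ys) (sumOver-comm (splicings ∘ Fᵧ) ys (allFin n)) ⟩
      M * sumOver (F x̂ ẑ) ys + ∑ (λ i → sumOver (λ y → splicings (Fᵧ y) i) ys)
        ≈⟨ +-congˡ (∑-cong (λ i → sumOver-distrib (F (spliced true i x̂) (spliced true i ẑ))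
                                                  (F (spliced false i x̂) (spliced false i ẑ)) ys)) ⟩
      recurrence (λ x′ z′ → sumOver (F x′ z′) ys) ∎
      where
      M = - (maxFactor x z true + maxFactor x z false)
      Fᵧ = λ y x′ z′ → F x′ z′ y

    sumOver-choices : ∀ {w} → IsSignedPerm w →
      sumOver (λ cε → weight x z (insertMax′ (w , cε))) (choices n) ≈ recurrence (λ x′ z′ → weight x′ z′ w)
    sumOver-choices {w} inj = begin
      sumOver (λ cε → weight x z (insertMax′ (w , cε))) (choices n)
        ≈⟨ sumOver-cartesianProduct (λ cε → weight x z (insertMax′ (w , cε))) (nothing ∷ map just (allFin n)) bools ⟩
      Wₙ + sumOver (λ c → W c true + (W c false + 0#)) (map just (allFin n))
        ≡⟨ ≡.cong (Wₙ +_) (sumOver-map (λ c → W c true + (W c false + 0#)) just (allFin n)) ⟩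
      Wₙ + ∑ (λ i → W (just i) true + (W (just i) false + 0#))
        ≈⟨ +-cong (+-cong (weight-insertMax-nothing w inj x z true)
                          (≈-trans (+-identityʳ _) (weight-insertMax-nothing w inj x z false)))
                  (∑-cong (λ i → +-cong (weight-insertMax-just w inj x z true i)
                                        (≈-trans (+-identityʳ _) (weight-insertMax-just w inj x z false i)))) ⟩
      (- maxFactor x z true * weight x̂ ẑ w + - maxFactor x z false * weight x̂ ẑ w) + _
        ≈⟨ +-congʳ (solve 3 (λ a b W → :- a :* W :+ :- b :* W := :- (a :+ b) :* W) ≈-refl _ _ _) ⟩
      recurrence (λ x′ z′ → weight x′ z′ w) ∎
      where
      W : Maybe (Fin n) → Bool → Carrier
      W c ε = weight x z (insertMax w c ε)
      Wₙ = W nothing true + (W nothing false + 0#)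

    total-suc : total (suc n) x z ≈ recurrence (total n)
    total-suc = begin
      sumOver (weight x z) (Bn (suc n))
        ≈⟨ sumOver-↭ (weight x z) (Bn-suc↭ n) ⟩
      sumOver (weight x z) (map insertMax′ (cartesianProduct (Bn n) (choices n)))
        ≡⟨ sumOver-map (weight x z) insertMax′ (cartesianProduct (Bn n) (choices n)) ⟩
      sumOver (weight x z ∘ insertMax′) (cartesianProduct (Bn n) (choices n))
        ≈⟨ sumOver-cartesianProduct (weight x z ∘ insertMax′) (Bn n) (choices n) ⟩
      sumOver (λ w → sumOver (λ cε → weight x z (insertMax′ (w , cε))) (choices n)) (Bn n)
        ≈⟨ sumOver-cong (Bn n) (λ {w} w∈ → sumOver-choices (Equivalence.to (∈-Bn⇔IsSignedPerm w) w∈)) ⟩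
      sumOver (λ w → recurrence (λ x′ z′ → weight x′ z′ w)) (Bn n)
        ≈⟨ sumOver-recurrence weight (Bn n) ⟩
      recurrence (total n) ∎

  closedForm : ∀ m → (Fin (suc m) → Carrier) → (Fin (suc m) → Carrier) → Carrier
  closedForm m x z = - (z (fromℕ m) + pow R (- 1#) m * x (fromℕ m) * pow R s (suc m) * pow R t (triangle (suc m)))
                   * Π.∑ (λ j → x (inject₁ j) - z (inject₁ j))

  module _ m (f g : Fin (suc m) → Carrier) (κ : Carrier) where

    closedForm-updateAt-inject₁ : ∀ j →
      closedForm m (updateAt f (inject₁ j) (const κ)) (updateAt g (inject₁ j) (const κ)) ≈ 0#
    closedForm-updateAt-inject₁ j = ≈-trans (*-congˡ (∏-zero _ j κ-κ≈0)) (zeroʳ _)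
      where
      κ-κ≈0 : updateAt f (inject₁ j) (const κ) (inject₁ j) - updateAt g (inject₁ j) (const κ) (inject₁ j) ≈ 0#
      κ-κ≈0 = ≈-trans (reflexive (≡.cong₂ _-_ (updateAt-updates (inject₁ j) f) (updateAt-updates (inject₁ j) g)))
                      (-‿inverseʳ κ)

    closedForm-updateAt-last : closedForm m (updateAt f (fromℕ m) (const κ)) (updateAt g (fromℕ m) (const κ))
      ≈ - (κ + pow R (- 1#) m * κ * pow R s (suc m) * pow R t (triangle (suc m)))
        * Π.∑ (λ j → f (inject₁ j) - g (inject₁ j))
    closedForm-updateAt-last = *-cong
      (reflexive (≡.cong₂ (λ a b → - (a + pow R (- 1#) m * b * pow R s (suc m) * pow R t (triangle (suc m))))
        (updateAt-updates (fromℕ m) g) (updateAt-updates (fromℕ m) f)))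
      (Π.∑-cong (λ j → reflexive (≡.cong₂ _-_ (updateAt-minimal (inject₁ j) (fromℕ m) f (inject₁≢fromℕ j))
                                              (updateAt-minimal (inject₁ j) (fromℕ m) g (inject₁≢fromℕ j)))))
      where
      inject₁≢fromℕ : ∀ j → inject₁ j ≡.≢ fromℕ m
      inject₁≢fromℕ j eq = fromℕ≢inject₁ (≡.sym eq)

  closedForm-suc : ∀ m (x z : Fin (suc (suc m)) → Carrier) → recurrence x z (closedForm m) ≈ closedForm (suc m) x z
  closedForm-suc m x z = begin
    - (Mᵀ + Mᶠ) * closedForm m x̂ ẑ + ∑ S
      ≈⟨ +-congˡ (∑-init-last S) ⟩
    - (Mᵀ + Mᶠ) * closedForm m x̂ ẑ + (∑ (S ∘ inject₁) + S (fromℕ m))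
      ≈⟨ +-congˡ (+-cong (sumOver-identity (allFin m) vanishing) lastSplicing) ⟩
    - (Mᵀ + Mᶠ) * (- (Z + a * X * Sₘ * Tₘ) * Q)
      + (0# + (- (κᵀ + a * κᵀ * Sₘ * Tₘ) * Q + - (κᶠ + a * κᶠ * Sₘ * Tₘ) * Q))
      ≈⟨ solve 10 (λ zₗ xₗ s Tₙ Z X a Sₘ Tₘ Q →
           let Mᵀ = xₗ :* s :* Tₙ; κᵀ = Z :* Mᵀ; κᶠ = X :* zₗ in
           :- (Mᵀ :+ zₗ) :* (:- (Z :+ a :* X :* Sₘ :* Tₘ) :* Q)
             :+ (con 0ℤ :+ (:- (κᵀ :+ a :* κᵀ :* Sₘ :* Tₘ) :* Q :+ :- (κᶠ :+ a :* κᶠ :* Sₘ :* Tₘ) :* Q))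
           := :- (zₗ :+ (:- con 1ℤ :* a) :* xₗ :* (s :* Sₘ) :* (Tₘ :* Tₙ)) :* (Q :* (X :+ :- Z)))
           ≈-refl Ẑₗ X̂ₗ s Tₙ Z X a Sₘ Tₘ Q ⟩
    - (Ẑₗ + (- 1# * a) * X̂ₗ * (s * Sₘ) * (Tₘ * Tₙ)) * (Q * (X - Z))
      ≈⟨ *-cong (-‿cong (+-congˡ (*-congˡ (≈-sym powₜ)))) (≈-sym (Π.∑-init-last (λ j → x (inject₁ j) - z (inject₁ j))))
      ⟩
    closedForm (suc m) x z ∎
    where
    x̂ ẑ : Fin (suc m) → Carrier
    x̂ = x ∘ inject₁
    ẑ = z ∘ inject₁
    Mᵀ = maxFactor x z true
    Mᶠ = maxFactor x z false
    X̂ₗ = x (fromℕ (suc m))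
    Ẑₗ = z (fromℕ (suc m))
    X = x̂ (fromℕ m)
    Z = ẑ (fromℕ m)
    κᵀ = spliceFactor x z true (fromℕ m)
    κᶠ = spliceFactor x z false (fromℕ m)
    a = pow R (- 1#) m
    Sₘ = pow R s (suc m)
    Tₘ = pow R t (triangle (suc m))
    Tₙ = pow R t (suc (suc m))
    Q = Π.∑ (λ j → x̂ (inject₁ j) - ẑ (inject₁ j))
    S = splicings x z (closedForm m)
    vanishing : ∀ j → S (inject₁ j) ≈ 0#
    vanishing j = ≈-trans (+-cong (closedForm-updateAt-inject₁ m x̂ ẑ _ j) (closedForm-updateAt-inject₁ m x̂ ẑ _ j))
                          (+-identityʳ 0#)
    lastSplicing : S (fromℕ m) ≈ - (κᵀ + a * κᵀ * Sₘ * Tₘ) * Q + - (κᶠ + a * κᶠ * Sₘ * Tₘ) * Q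
    lastSplicing = +-cong (closedForm-updateAt-last m x̂ ẑ κᵀ) (closedForm-updateAt-last m x̂ ẑ κᶠ)
    powₜ : pow R t (triangle (suc (suc m))) ≈ Tₘ * Tₙ
    powₜ = ≈-trans (reflexive (≡.cong (pow R t) (triangle-suc (suc m)))) (pow-+ t (triangle (suc m)) (suc (suc m)))

  total-closedForm : ∀ m x z → total (suc m) x z ≈ closedForm m x z
  total-closedForm zero x z = begin
    total 1 x z
      ≡⟨⟩
    (- 1# * 1#) * (s * 1#) * (t * 1#) * (x zero * 1#) + ((- 1# * 1#) * 1# * 1# * (z zero * 1#) + 0#)
      ≈⟨ solve 4 (λ s t x z → (:- con 1ℤ :* con 1ℤ) :* (s :* con 1ℤ) :* (t :* con 1ℤ) :* (x :* con 1ℤ)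
                              :+ ((:- con 1ℤ :* con 1ℤ) :* con 1ℤ :* con 1ℤ :* (z :* con 1ℤ) :+ con 0ℤ)
                            := :- (z :+ con 1ℤ :* x :* (s :* con 1ℤ) :* (t :* con 1ℤ)) :* con 1ℤ)
                 ≈-refl s t (x zero) (z zero) ⟩
    - (z zero + 1# * x zero * (s * 1#) * (t * 1#)) * 1#
      ≡⟨⟩
    closedForm 0 x z ∎
  total-closedForm (suc m) x z = begin
    total (suc (suc m)) x z               ≈⟨ total-suc x z ⟩
    recurrence x z (total (suc m))        ≈⟨ recurrence-cong x z (total-closedForm m) ⟩
    recurrence x z (closedForm m)         ≈⟨ closedForm-suc m x z ⟩
    closedForm (suc m) x z                ∎

theorem4p1 : ∀ {c ℓ} (R : CommutativeRing c ℓ) (m : ℕ)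
    (x : Fin (suc m) → CommutativeRing.Carrier R) (s t : CommutativeRing.Carrier R) →
    CommutativeRing._≈_ R (lhs R (suc m) x s t) (rhs R m x s t)
theorem4p1 R m x s t = WeightedSum.total-closedForm R s t m x (const (CommutativeRing.1# R))
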